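{- Let $\Gamma$ be a finite set of MSO formulas and $\Phi_1,\Phi_2$ core-wMSO$(?,+)$ formulas in normal form. If $\Phi_1\sim_\Gamma\Phi_2$ then $\Gamma\vdash\Phi_1\approx\Phi_2$ in the core-wMSO$(?,+)$ proof system.
   Context: MSO over a finite alphabet $\Sigma$ (syntax $\top, P_a(x), x\le y, x\in X,\neg,\wedge,\forall x,\forall X$), interpreted over $(w,\sigma)$ with $w\in\Sigma^+$ and $\sigma$ a valuation; $\Gamma\vdash\varphi$ refers to a fixed sound and complete proof system for MSO over finite nonempty words. step-wMSO over weights $R$: $\Psi::=r\mid\varphi\,?\,\Psi_1:\Psi_2$ ($[\![r]\!]=r$; conditional selects by $\varphi$). core-wMSO$(?,+)$: $\Phi::=\mathbf{0}\mid\prod_x\Psi\mid\varphi\,?\,\Phi_1:\Phi_2\mid\Phi_1+\Phi_2$, with semantics in finite multisets of words over $R$: $[\![\mathbf{0}]\!]=\emptyset$, $[\![\prod_x\Psi]\!](w,\sigma)$ the multiset with the single word $r_1\cdots r_{|w|}$, $r_i=[\![\Psi]\!](w,\sigma[x\mapsto i])$, conditional selecting by $\varphi$, $+$ is multiset union. Normal form: generated by $N::=\varphi\,?\,N_1:N_2\mid M\mid\mathbf{0}$, $M::=\prod_x\Psi\mid M_1+M_2$. $\chi_1\sim_\Gamma\chi_2$: equal semantics on all $(w,\sigma)$ satisfying all of $\Gamma$. The core-wMSO$(?,+)$ proof system derives $\Gamma\vdash\chi_1\approx\chi_2$ by: (ref), (sym), (trans); (cong?), (cong+) congruence for the conditional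 and $+$; (S1)/(C6) $\Gamma\vdash\chi_1\approx\chi_2\Rightarrow\Gamma\cup\{\varphi\}\vdash\chi_1\approx\chi_2$; (S2)/(C7) $\Gamma\vdash\neg\varphi\,?\,\chi_1:\chi_2\approx\varphi\,?\,\chi_2:\chi_1$; (S3)/(C8) $\Gamma\vdash\varphi\Rightarrow\Gamma\vdash\varphi\,?\,\chi_1:\chi_2\approx\chi_1$; (S4)/(C9) $\Gamma\cup\{\varphi\}\vdash\chi_1\approx\chi$ and $\Gamma\cup\{\neg\varphi\}\vdash\chi_2\approx\chi\Rightarrow\Gamma\vdash\varphi\,?\,\chi_1:\chi_2\approx\chi$ (S versions for step formulas, C versions for core formulas); (C1) $\Gamma\vdash\Phi+\mathbf{0}\approx\Phi$; (C2) commutativity, (C3) associativity of $+$; (C4) $\Gamma\vdash\Psi_1\approx\Psi_2$ with $x$ not free in $\Gamma$ implies $\Gamma\vdash\prod_x\Psi_1\approx\prod_x\Psi_2$; (C5) $\Gamma\vdash\prod_x\Psi\approx\prod_y\Psi[y/x]$ if $y$ does not occur in $\Psi$; (C10) $\Gamma\vdash(\varphi\,?\,\Phi':\Phi'')+\Phi\approx\varphi\,?\,(\Phi'+\Phi):(\Phi''+\Phi)$. -}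

module Defs where

open import Data.Nat using (ℕ; zero; suc; _≡ᵇ_)
open import Data.Fin using (Fin; zero; suc)
import Data.Fin.Properties as FinP
open import Data.Bool using (Bool; true; false; not; _∧_; _∨_; if_then_else_)
open import Data.List using (List; []; _∷_; _++_; tabulate; allFin; concatMap)
open import Data.List.Relation.Unary.All using (All)
open import Data.List.Membership.Propositional using (_∈_)
open import Data.List.Relation.Binary.Permutation.Propositional using (_↭_)
open import Data.Vec using (Vec; lookup)
open import Data.Product using (_×_)
open import Data.Sum using (_⊎_)
open import Relation.Nullary.Decidable using (⌊_⌋)
open import Relation.Binary.PropositionalEquality using (_≡_)

-- MSO over the finite alphabet Σ = Fin k.
-- First-order and second-order variables are natural numbers
-- (two separate name spaces).

data Formula (k : ℕ) : Set where
  ⊤'  : Formula k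
  P   : Fin k → ℕ → Formula k
  _≤'_ : ℕ → ℕ → Formula k
  _∈'_ : ℕ → ℕ → Formula k
  ¬'_ : Formula k → Formula k
  _∧'_ : Formula k → Formula k → Formula k
  ∀₁  : ℕ → Formula k → Formula k
  ∀₂  : ℕ → Formula k → Formula k

record Val (n : ℕ) : Set where
  field
    fo : ℕ → Fin n
    so : ℕ → Fin n → Bool
open Val public

_[_↦₁_] : ∀ {n} → Val n → ℕ → Fin n → Val n
fo (σ [ x ↦₁ i ]) y = if y ≡ᵇ x then i else fo σ y
so (σ [ x ↦₁ i ]) = so σ

_[_↦₂_] : ∀ {n} → Val n → ℕ → (Fin n → Bool) → Val n
fo (σ [ X ↦₂ S ]) = fo σ
so (σ [ X ↦₂ S ]) Y = if Y ≡ᵇ X then S else so σ Y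

allB : ∀ {A : Set} → (A → Bool) → List A → Bool
allB p [] = true
allB p (a ∷ as) = p a ∧ allB p as

consS : ∀ {n} → Bool → (Fin n → Bool) → Fin (suc n) → Bool
consS b S zero = b
consS b S (suc i) = S i

subsets : (n : ℕ) → List (Fin n → Bool)
subsets zero = (λ ()) ∷ []
subsets (suc n) = concatMap (λ S → consS false S ∷ consS true S ∷ []) (subsets n)

sat : ∀ {k n} → Vec (Fin k) n → Val n → Formula k → Bool
sat w σ ⊤' = true
sat w σ (P a x) = ⌊ lookup w (fo σ x) FinP.≟ a ⌋
sat w σ (x ≤' y) = ⌊ fo σ x FinP.≤? fo σ y ⌋
sat w σ (x ∈' X) = so σ X (fo σ x)
sat w σ (¬' φ) = not (sat w σ φ)
sat w σ (φ ∧' ψ) = sat w σ φ ∧ sat w σ ψ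
sat {n = n} w σ (∀₁ x φ) = allB (λ i → sat w (σ [ x ↦₁ i ]) φ) (allFin n)
sat {n = n} w σ (∀₂ X φ) = allB (λ S → sat w (σ [ X ↦₂ S ]) φ) (subsets n)

Holds : ∀ {k n} → List (Formula k) → Vec (Fin k) n → Val n → Set
Holds Γ w σ = All (λ ψ → sat w σ ψ ≡ true) Γ

_⊨_ : ∀ {k} → List (Formula k) → Formula k → Set
_⊨_ {k} Γ φ = ∀ (m : ℕ) (w : Vec (Fin k) (suc m)) (σ : Val (suc m)) →
  Holds Γ w σ → sat w σ φ ≡ true

Sound : ∀ {k} → (List (Formula k) → Formula k → Set) → Set
Sound {k} _⊢_ = ∀ (Γ : List (Formula k)) (φ : Formula k) → Γ ⊢ φ → Γ ⊨ φ

Complete : ∀ {k} → (List (Formula k) → Formula k → Set) → Set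
Complete {k} _⊢_ = ∀ (Γ : List (Formula k)) (φ : Formula k) → Γ ⊨ φ → Γ ⊢ φ

freeFO : ∀ {k} → ℕ → Formula k → Bool
freeFO x ⊤' = false
freeFO x (P a y) = x ≡ᵇ y
freeFO x (y ≤' z) = (x ≡ᵇ y) ∨ (x ≡ᵇ z)
freeFO x (y ∈' X) = x ≡ᵇ y
freeFO x (¬' φ) = freeFO x φ
freeFO x (φ ∧' ψ) = freeFO x φ ∨ freeFO x ψ
freeFO x (∀₁ y φ) = not (x ≡ᵇ y) ∧ freeFO x φ
freeFO x (∀₂ X φ) = freeFO x φ

occursFO : ∀ {k} → ℕ → Formula k → Bool
occursFO x ⊤' = false
occursFO x (P a y) = x ≡ᵇ y
occursFO x (y ≤' z) = (x ≡ᵇ y) ∨ (x ≡ᵇ z)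
occursFO x (y ∈' X) = x ≡ᵇ y
occursFO x (¬' φ) = occursFO x φ
occursFO x (φ ∧' ψ) = occursFO x φ ∨ occursFO x ψ
occursFO x (∀₁ y φ) = (x ≡ᵇ y) ∨ occursFO x φ
occursFO x (∀₂ X φ) = occursFO x φ

substFO : ∀ {k} → ℕ → ℕ → Formula k → Formula k
substFO y x ⊤' = ⊤'
substFO y x (P a z) = P a (if z ≡ᵇ x then y else z)
substFO y x (z ≤' z') = (if z ≡ᵇ x then y else z) ≤' (if z' ≡ᵇ x then y else z')
substFO y x (z ∈' X) = (if z ≡ᵇ x then y else z) ∈' X
substFO y x (¬' φ) = ¬' substFO y x φ
substFO y x (φ ∧' ψ) = substFO y x φ ∧' substFO y x ψ
substFO y x (∀₁ z φ) = if z ≡ᵇ x then ∀₁ z φ else ∀₁ z (substFO y x φ)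
substFO y x (∀₂ X φ) = ∀₂ X (substFO y x φ)

data Step (k : ℕ) (R : Set) : Set where
  wt   : R → Step k R
  cond : Formula k → Step k R → Step k R → Step k R

data Core (k : ℕ) (R : Set) : Set where
  𝟎    : Core k R
  prod : ℕ → Step k R → Core k R
  cond : Formula k → Core k R → Core k R → Core k R
  _⊕_  : Core k R → Core k R → Core k R

⟦_⟧ˢ : ∀ {k R n} → Step k R → Vec (Fin k) n → Val n → R
⟦ wt r ⟧ˢ w σ = r
⟦ cond φ Ψ₁ Ψ₂ ⟧ˢ w σ = if sat w σ φ then ⟦ Ψ₁ ⟧ˢ w σ else ⟦ Ψ₂ ⟧ˢ w σ

-- finite multisets of words over R are lists of lists, compared up to
-- permutation (_↭_)
⟦_⟧ᶜ : ∀ {k R n} → Core k R → Vec (Fin k) n → Val n → List (List R)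
⟦ 𝟎 ⟧ᶜ w σ = []
⟦ prod x Ψ ⟧ᶜ w σ = tabulate (λ i → ⟦ Ψ ⟧ˢ w (σ [ x ↦₁ i ])) ∷ []
⟦ cond φ Φ₁ Φ₂ ⟧ᶜ w σ = if sat w σ φ then ⟦ Φ₁ ⟧ᶜ w σ else ⟦ Φ₂ ⟧ᶜ w σ
⟦ Φ₁ ⊕ Φ₂ ⟧ᶜ w σ = ⟦ Φ₁ ⟧ᶜ w σ ++ ⟦ Φ₂ ⟧ᶜ w σ

_∼[_]_ : ∀ {k R} → Core k R → List (Formula k) → Core k R → Set
_∼[_]_ {k} Φ₁ Γ Φ₂ = ∀ (m : ℕ) (w : Vec (Fin k) (suc m)) (σ : Val (suc m)) →
  Holds Γ w σ → ⟦ Φ₁ ⟧ᶜ w σ ↭ ⟦ Φ₂ ⟧ᶜ w σ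

occursStep : ∀ {k R} → ℕ → Step k R → Bool
occursStep x (wt r) = false
occursStep x (cond φ Ψ₁ Ψ₂) = occursFO x φ ∨ occursStep x Ψ₁ ∨ occursStep x Ψ₂

substStep : ∀ {k R} → ℕ → ℕ → Step k R → Step k R
substStep y x (wt r) = wt r
substStep y x (cond φ Ψ₁ Ψ₂) = cond (substFO y x φ) (substStep y x Ψ₁) (substStep y x Ψ₂)

data IsM {k R} : Core k R → Set where
  m-prod : ∀ x Ψ → IsM (prod x Ψ)
  m-plus : ∀ {M₁ M₂} → IsM M₁ → IsM M₂ → IsM (M₁ ⊕ M₂)

data IsNF {k R} : Core k R → Set where
  nf-cond : ∀ φ {N₁ N₂} → IsNF N₁ → IsNF N₂ → IsNF (cond φ N₁ N₂)
  nf-M    : ∀ {M} → IsM M → IsNF M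
  nf-𝟎    : IsNF 𝟎

-- Contexts Γ are finite sets of formulas, represented by lists;
-- Γ ∪ {φ} is any list with the same elements as φ ∷ Γ.
SetEq : ∀ {k} → List (Formula k) → List (Formula k) → Set
SetEq Δ Γ = ∀ ψ → (ψ ∈ Δ → ψ ∈ Γ) × (ψ ∈ Γ → ψ ∈ Δ)

NotFreeIn : ∀ {k} → ℕ → List (Formula k) → Set
NotFreeIn x Γ = All (λ φ → freeFO x φ ≡ false) Γ

module ProofSystem {k : ℕ} {R : Set} (_⊢ᴹ_ : List (Formula k) → Formula k → Set) where

  infix 4 _⊢ˢ_≈_ _⊢ᶜ_≈_

  data _⊢ˢ_≈_ : List (Formula k) → Step k R → Step k R → Set where
    ref   : ∀ {Γ Ψ} → Γ ⊢ˢ Ψ ≈ Ψ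
    sym   : ∀ {Γ Ψ₁ Ψ₂} → Γ ⊢ˢ Ψ₁ ≈ Ψ₂ → Γ ⊢ˢ Ψ₂ ≈ Ψ₁
    trans : ∀ {Γ Ψ₁ Ψ₂ Ψ₃} → Γ ⊢ˢ Ψ₁ ≈ Ψ₂ → Γ ⊢ˢ Ψ₂ ≈ Ψ₃ → Γ ⊢ˢ Ψ₁ ≈ Ψ₃
    cong? : ∀ {Γ φ Ψ₁ Ψ₁' Ψ₂ Ψ₂'} → Γ ⊢ˢ Ψ₁ ≈ Ψ₁' → Γ ⊢ˢ Ψ₂ ≈ Ψ₂' →
            Γ ⊢ˢ cond φ Ψ₁ Ψ₂ ≈ cond φ Ψ₁' Ψ₂'
    S1    : ∀ {Γ Δ φ Ψ₁ Ψ₂} → Γ ⊢ˢ Ψ₁ ≈ Ψ₂ → SetEq Δ (φ ∷ Γ) → Δ ⊢ˢ Ψ₁ ≈ Ψ₂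
    S2    : ∀ {Γ φ Ψ₁ Ψ₂} → Γ ⊢ˢ cond (¬' φ) Ψ₁ Ψ₂ ≈ cond φ Ψ₂ Ψ₁
    S3    : ∀ {Γ φ Ψ₁ Ψ₂} → Γ ⊢ᴹ φ → Γ ⊢ˢ cond φ Ψ₁ Ψ₂ ≈ Ψ₁
    S4    : ∀ {Γ φ Ψ₁ Ψ₂ Ψ} → (φ ∷ Γ) ⊢ˢ Ψ₁ ≈ Ψ → ((¬' φ) ∷ Γ) ⊢ˢ Ψ₂ ≈ Ψ →
            Γ ⊢ˢ cond φ Ψ₁ Ψ₂ ≈ Ψ

  data _⊢ᶜ_≈_ : List (Formula k) → Core k R → Core k R → Set where
    ref   : ∀ {Γ Φ} → Γ ⊢ᶜ Φ ≈ Φ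
    sym   : ∀ {Γ Φ₁ Φ₂} → Γ ⊢ᶜ Φ₁ ≈ Φ₂ → Γ ⊢ᶜ Φ₂ ≈ Φ₁
    trans : ∀ {Γ Φ₁ Φ₂ Φ₃} → Γ ⊢ᶜ Φ₁ ≈ Φ₂ → Γ ⊢ᶜ Φ₂ ≈ Φ₃ → Γ ⊢ᶜ Φ₁ ≈ Φ₃
    cong? : ∀ {Γ φ Φ₁ Φ₁' Φ₂ Φ₂'} → Γ ⊢ᶜ Φ₁ ≈ Φ₁' → Γ ⊢ᶜ Φ₂ ≈ Φ₂' →
            Γ ⊢ᶜ cond φ Φ₁ Φ₂ ≈ cond φ Φ₁' Φ₂'
    cong+ : ∀ {Γ Φ₁ Φ₁' Φ₂ Φ₂'} → Γ ⊢ᶜ Φ₁ ≈ Φ₁' → Γ ⊢ᶜ Φ₂ ≈ Φ₂' →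
            Γ ⊢ᶜ Φ₁ ⊕ Φ₂ ≈ Φ₁' ⊕ Φ₂'
    C1    : ∀ {Γ Φ} → Γ ⊢ᶜ Φ ⊕ 𝟎 ≈ Φ
    C2    : ∀ {Γ Φ₁ Φ₂} → Γ ⊢ᶜ Φ₁ ⊕ Φ₂ ≈ Φ₂ ⊕ Φ₁
    C3    : ∀ {Γ Φ₁ Φ₂ Φ₃} → Γ ⊢ᶜ (Φ₁ ⊕ Φ₂) ⊕ Φ₃ ≈ Φ₁ ⊕ (Φ₂ ⊕ Φ₃)
    C4    : ∀ {Γ x Ψ₁ Ψ₂} → Γ ⊢ˢ Ψ₁ ≈ Ψ₂ → NotFreeIn x Γ →
            Γ ⊢ᶜ prod x Ψ₁ ≈ prod x Ψ₂
    C5    : ∀ {Γ x y Ψ} → occursStep y Ψ ≡ false →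
            Γ ⊢ᶜ prod x Ψ ≈ prod y (substStep y x Ψ)
    C6    : ∀ {Γ Δ φ Φ₁ Φ₂} → Γ ⊢ᶜ Φ₁ ≈ Φ₂ → SetEq Δ (φ ∷ Γ) → Δ ⊢ᶜ Φ₁ ≈ Φ₂
    C7    : ∀ {Γ φ Φ₁ Φ₂} → Γ ⊢ᶜ cond (¬' φ) Φ₁ Φ₂ ≈ cond φ Φ₂ Φ₁
    C8    : ∀ {Γ φ Φ₁ Φ₂} → Γ ⊢ᴹ φ → Γ ⊢ᶜ cond φ Φ₁ Φ₂ ≈ Φ₁
    C9    : ∀ {Γ φ Φ₁ Φ₂ Φ} → (φ ∷ Γ) ⊢ᶜ Φ₁ ≈ Φ → ((¬' φ) ∷ Γ) ⊢ᶜ Φ₂ ≈ Φ →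
            Γ ⊢ᶜ cond φ Φ₁ Φ₂ ≈ Φ
    C10   : ∀ {Γ φ Φ' Φ'' Φ} →
            Γ ⊢ᶜ (cond φ Φ' Φ'') ⊕ Φ ≈ cond φ (Φ' ⊕ Φ) (Φ'' ⊕ Φ)

-- C9 splits the conditionals on both sides, so it suffices to prove semantically equal sums of
-- products equal. A product ∏x Ψ on the left equals some product ∏y Ψ′ on the right, but which
-- one may depend on the model. After renaming both variables to a fresh z (C5), split (C9) on
-- "some position z satisfies the conditions of this pair of leaves" for every pair of leaves of
-- Ψ and Ψ′. In each branch either the context is unsatisfiable, and then ⊤ and ¬⊤ are provable by
-- completeness so everything is derivable, or it has a model; the partner chosen in that model
-- works in every model of the branch, since each pair of leaves is either reached at some position
-- of that model (so its weights coincide) or reached nowhere in any model. S4 and C4 then prove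
-- the two products equal, and the remaining sums are handled by induction.
--
-- Constructively "unsatisfiable or has a model" needs satisfiability of MSO over finite words to
-- be decidable (Büchi): formulas are compiled to automata over letters recording the valuation,
-- quantifiers by the subset construction, and emptiness is decided by a pigeonhole bound.

module Submission where

open import Defs
open import Algebra using (CommutativeMonoid)
open import Data.Nat as ℕ using (ℕ; zero; suc; _≡ᵇ_; _⊔_; _⊓_; _<_; _≤_; _∸_; _+_; s≤s; z≤n)
import Data.Nat.Properties as ℕP
open import Data.Fin using (Fin; zero; suc; toℕ; combine; remQuot)
import Data.Fin.Properties as FinP
open import Data.Bool using (Bool; true; false; not; _∧_; _∨_; if_then_else_)
open import Data.Bool.ListAction using (any)
import Data.Bool.Properties as BP
open import Data.List using (List; []; _∷_; _++_; tabulate; allFin; concatMap; length; take; drop; foldl)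
import Data.List.Properties as LP
open import Data.List.Relation.Unary.All as All using (All; []; _∷_)
import Data.List.Relation.Unary.All.Properties as AllP
open import Data.List.Relation.Unary.Any as Any using (here; there)
open import Data.List.Membership.Propositional using (_∈_)
open import Data.List.Membership.Propositional.Properties using (∈-++⁺ˡ; ∈-++⁺ʳ; ∈-concatMap⁺; ∈-allFin)
open import Data.List.Relation.Binary.Permutation.Propositional using (_↭_)
import Data.List.Relation.Binary.Permutation.Propositional.Properties as ↭P
open import Data.Vec as V using (Vec; lookup)
import Data.Vec.Properties as VP
open import Data.Product as Prod using (∃; _×_; _,_; proj₁; proj₂)
open import Data.Sum as Sum using (_⊎_; inj₁; inj₂)
open import Data.Empty using (⊥-elim)
open import Data.Unit using (⊤; tt)
open import Relation.Nullary using (¬_; Dec; yes; no)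
open import Relation.Nullary.Decidable as Dec using (⌊_⌋)
open import Relation.Binary.PropositionalEquality

open import Algebra.Properties.CommutativeSemigroup
  (CommutativeMonoid.commutativeSemigroup BP.∨-commutativeMonoid) using (interchange)

anyF : ∀ {n} → (Fin n → Bool) → Bool
anyF {zero}  f = false
anyF {suc n} f = f zero ∨ anyF (λ i → f (suc i))

allF : ∀ {n} → (Fin n → Bool) → Bool
allF {zero}  f = true
allF {suc n} f = f zero ∧ allF (λ i → f (suc i))

anyF-cong : ∀ {n} {f g : Fin n → Bool} → (∀ i → f i ≡ g i) → anyF f ≡ anyF g
anyF-cong {zero}  e = refl
anyF-cong {suc n} e = cong₂ _∨_ (e zero) (anyF-cong (λ i → e (suc i)))

anyF-false : ∀ n → anyF {n} (λ _ → false) ≡ false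
anyF-false zero    = refl
anyF-false (suc n) = anyF-false n

anyF-∨ : ∀ {n} (f g : Fin n → Bool) → anyF (λ i → f i ∨ g i) ≡ anyF f ∨ anyF g
anyF-∨ {zero}  f g = refl
anyF-∨ {suc n} f g rewrite anyF-∨ (λ i → f (suc i)) (λ i → g (suc i)) = interchange (f zero) (g zero) _ _

anyF-∧ʳ : ∀ {n} (f : Fin n → Bool) b → anyF (λ i → f i ∧ b) ≡ anyF f ∧ b
anyF-∧ʳ {zero}  f b = refl
anyF-∧ʳ {suc n} f b rewrite anyF-∧ʳ (λ i → f (suc i)) b = sym (BP.∧-distribʳ-∨ b (f zero) _)

anyF-∧ˡ : ∀ {n} b (f : Fin n → Bool) → anyF (λ i → b ∧ f i) ≡ b ∧ anyF f
anyF-∧ˡ {n} false f = anyF-false n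
anyF-∧ˡ     true  f = refl

anyF-comm : ∀ {m n} (h : Fin m → Fin n → Bool) →
  anyF (λ i → anyF (λ j → h i j)) ≡ anyF (λ j → anyF (λ i → h i j))
anyF-comm {zero}  {n} h = sym (anyF-false n)
anyF-comm {suc m}     h = trans (cong (anyF (h zero) ∨_) (anyF-comm (λ i → h (suc i))))
                                (sym (anyF-∨ (h zero) (λ j → anyF (λ i → h (suc i) j))))

anyF-true⁻ : ∀ {n} (f : Fin n → Bool) → anyF f ≡ true → ∃ λ i → f i ≡ true
anyF-true⁻ {suc n} f e with f zero in eq
... | true  = zero , eq
... | false = let i , p = anyF-true⁻ (λ i → f (suc i)) e in suc i , p

anyF-true⁺ : ∀ {n} (f : Fin n → Bool) i → f i ≡ true → anyF f ≡ true
anyF-true⁺ f zero    e rewrite e = refl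
anyF-true⁺ f (suc i) e rewrite anyF-true⁺ (λ i → f (suc i)) i e = BP.∨-zeroʳ (f zero)

allF≡not-anyF-not : ∀ {n} (f : Fin n → Bool) → allF f ≡ not (anyF (λ i → not (f i)))
allF≡not-anyF-not {zero}  f = refl
allF≡not-anyF-not {suc n} f with f zero
... | true  = allF≡not-anyF-not (λ i → f (suc i))
... | false = refl

allB-tabulate : ∀ {A : Set} {n} (p : A → Bool) (f : Fin n → A) → allB p (tabulate f) ≡ allF (λ i → p (f i))
allB-tabulate {n = zero}  p f = refl
allB-tabulate {n = suc n} p f = cong (p (f zero) ∧_) (allB-tabulate p (λ i → f (suc i)))

allB≡not-any-not : ∀ {A : Set} (p : A → Bool) (l : List A) → allB p l ≡ not (any (λ a → not (p a)) l)
allB≡not-any-not p []      = refl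
allB≡not-any-not p (a ∷ l) with p a
... | true  = allB≡not-any-not p l
... | false = refl

allB-cong : ∀ {A : Set} {p q : A → Bool} (l : List A) → (∀ a → p a ≡ q a) → allB p l ≡ allB q l
allB-cong []      e = refl
allB-cong (a ∷ l) e = cong₂ _∧_ (e a) (allB-cong l e)

any-cong : ∀ {A : Set} {f g : A → Bool} (l : List A) → (∀ a → f a ≡ g a) → any f l ≡ any g l
any-cong []      e = refl
any-cong (a ∷ l) e = cong₂ _∨_ (e a) (any-cong l e)

any-∨ : ∀ {A : Set} (f g : A → Bool) (l : List A) → any (λ a → f a ∨ g a) l ≡ any f l ∨ any g l
any-∨ f g []      = refl
any-∨ f g (a ∷ l) rewrite any-∨ f g l = interchange (f a) (g a) _ _

any-++ : ∀ {A : Set} (p : A → Bool) (l m : List A) → any p (l ++ m) ≡ any p l ∨ any p m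
any-++ p []      m = refl
any-++ p (a ∷ l) m rewrite any-++ p l m = sym (BP.∨-assoc (p a) _ _)

any-concatMap : ∀ {A B : Set} (p : B → Bool) (h : A → List B) (l : List A) →
  any p (concatMap h l) ≡ any (λ a → any p (h a)) l
any-concatMap p h []      = refl
any-concatMap p h (a ∷ l) = trans (any-++ p (h a) (concatMap h l)) (cong (any p (h a) ∨_) (any-concatMap p h l))

tabulate-injective : ∀ {A : Set} {n} {f g : Fin n → A} → tabulate f ≡ tabulate g → ∀ i → f i ≡ g i
tabulate-injective {n = suc n} e zero    = LP.∷-injectiveˡ e
tabulate-injective {n = suc n} e (suc i) = tabulate-injective (LP.∷-injectiveʳ e) i

eqF : ∀ {n} → Fin n → Fin n → Bool
eqF zero    zero    = true
eqF zero    (suc j) = false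
eqF (suc i) zero    = false
eqF (suc i) (suc j) = eqF i j

anyF-eqF : ∀ {n} (i : Fin n) (h : Fin n → Bool) → anyF (λ p → eqF i p ∧ h p) ≡ h i
anyF-eqF {suc n} zero    h rewrite anyF-false n = BP.∨-identityʳ (h zero)
anyF-eqF {suc n} (suc i) h = anyF-eqF i (λ p → h (suc p))

false≢true : false ≢ true
false≢true ()

≡ᵇ-refl : ∀ n → (n ≡ᵇ n) ≡ true
≡ᵇ-refl zero    = refl
≡ᵇ-refl (suc n) = ≡ᵇ-refl n

≡ᵇ-true⇒≡ : ∀ m n → (m ≡ᵇ n) ≡ true → m ≡ n
≡ᵇ-true⇒≡ zero    zero    e = refl
≡ᵇ-true⇒≡ (suc m) (suc n) e = cong suc (≡ᵇ-true⇒≡ m n e)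

≢⇒≡ᵇ-false : ∀ m n → m ≢ n → (m ≡ᵇ n) ≡ false
≢⇒≡ᵇ-false zero    zero    ne = ⊥-elim (ne refl)
≢⇒≡ᵇ-false zero    (suc n) ne = refl
≢⇒≡ᵇ-false (suc m) zero    ne = refl
≢⇒≡ᵇ-false (suc m) (suc n) ne = ≢⇒≡ᵇ-false m n (λ e → ne (cong suc e))

≡ᵇ-false⇒≢ : ∀ {m n} → (m ≡ᵇ n) ≡ false → m ≢ n
≡ᵇ-false⇒≢ {m} e refl = false≢true (trans (sym e) (≡ᵇ-refl m))

<⇒≡ᵇ-false : ∀ {m n} → m < n → (m ≡ᵇ n) ≡ false
<⇒≡ᵇ-false {m} {n} lt = ≢⇒≡ᵇ-false m n (ℕP.<⇒≢ lt)

>⇒≡ᵇ-false : ∀ {m n} → n < m → (m ≡ᵇ n) ≡ false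
>⇒≡ᵇ-false {m} {n} lt = ≢⇒≡ᵇ-false m n (λ e → ℕP.<⇒≢ lt (sym e))

not-flip : ∀ {a b} → not a ≡ b → a ≡ not b
not-flip {a} e = trans (sym (BP.not-involutive a)) (cong not e)

allB-false⁻ : ∀ {A : Set} (p : A → Bool) (l : List A) → allB p l ≡ false → ∃ λ a → p a ≡ false
allB-false⁻ p (a ∷ l) e with p a in eq
... | true  = allB-false⁻ p l e
... | false = a , eq

allB-false⁺ : ∀ {A : Set} (p : A → Bool) {l : List A} {a} → a ∈ l → p a ≡ false → allB p l ≡ false
allB-false⁺ p (here refl) e rewrite e = refl
allB-false⁺ p {b ∷ l} (there a∈l) e rewrite allB-false⁺ p a∈l e = BP.∧-zeroʳ (p b)

record Finite (S : Set) : Set where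
  field
    size          : ℕ
    index         : S → Fin size
    element       : Fin size → S
    element-index : ∀ s → element (index s) ≡ s

  index-injective : ∀ s t → index s ≡ index t → s ≡ t
  index-injective s t e = trans (sym (element-index s)) (trans (cong element e) (element-index t))

finite-Bool : Finite Bool
finite-Bool = record { size = 2 ; index = index ; element = element ; element-index = element-index }
  where
  index : Bool → Fin 2
  index false = zero
  index true  = suc zero
  element : Fin 2 → Bool
  element zero    = false
  element (suc _) = true
  element-index : ∀ b → element (index b) ≡ b
  element-index false = refl
  element-index true  = refl

finite-× : ∀ {S T} → Finite S → Finite T → Finite (S × T)
finite-× {S} {T} FS FT = record
  { size = FS.size ℕ.* FT.size
  ; index = λ (s , t) → combine (FS.index s) (FT.index t)
  ; element = λ i → Prod.map FS.element FT.element (remQuot FT.size i)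
  ; element-index = λ (s , t) →
      trans (cong (Prod.map FS.element FT.element) (FinP.remQuot-combine (FS.index s) (FT.index t)))
            (cong₂ _,_ (FS.element-index s) (FT.element-index t))
  }
  where
  module FS = Finite FS
  module FT = Finite FT

finite-retract : ∀ {S T} → Finite S → (f : S → T) (g : T → S) → (∀ t → f (g t) ≡ t) → Finite T
finite-retract FS f g fg = record
  { size = size ; index = λ t → index (g t) ; element = λ i → f (element i)
  ; element-index = λ t → trans (cong f (element-index (g t))) (fg t) }
  where open Finite FS

finite-⊤ : Finite ⊤
finite-⊤ = record { size = 1 ; index = λ _ → zero ; element = λ _ → tt ; element-index = λ _ → refl }

finite-Vec-Bool : ∀ n → Finite (Vec Bool n)
finite-Vec-Bool zero    = finite-retract finite-⊤ (λ _ → V.[]) (λ _ → tt) (λ { V.[] → refl })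
finite-Vec-Bool (suc n) = finite-retract (finite-× finite-Bool (finite-Vec-Bool n))
  (λ (b , v) → b V.∷ v) (λ { (b V.∷ v) → b , v }) (λ { (b V.∷ v) → refl })

-- MSO semantics: coincidence, closure and substitution

bound : ∀ {k} → Formula k → ℕ
bound ⊤'       = 0
bound (P a x)  = suc x
bound (x ≤' y) = suc x ⊔ suc y
bound (x ∈' X) = suc x ⊔ suc X
bound (¬' φ)   = bound φ
bound (φ ∧' ψ) = bound φ ⊔ bound ψ
bound (∀₁ x φ) = suc x ⊔ bound φ
bound (∀₂ X φ) = suc X ⊔ bound φ

⊔-≤⁻ˡ : ∀ m n {o} → m ⊔ n ≤ o → m ≤ o
⊔-≤⁻ˡ m n = ℕP.m⊔n≤o⇒m≤o m n

⊔-≤⁻ʳ : ∀ m n {o} → m ⊔ n ≤ o → n ≤ o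
⊔-≤⁻ʳ m n = ℕP.m⊔n≤o⇒n≤o m n

AgreeBelow : ∀ {n} → ℕ → Val n → Val n → Set
AgreeBelow B σ τ = (∀ v → v < B → fo σ v ≡ fo τ v) × (∀ V → V < B → ∀ i → so σ V i ≡ so τ V i)

AgreeBelow-↦₁ : ∀ {n B} {σ τ : Val n} x i → AgreeBelow B σ τ → AgreeBelow B (σ [ x ↦₁ i ]) (τ [ x ↦₁ i ])
AgreeBelow-↦₁ x i (ef , es) = (λ v lt → cong (if v ≡ᵇ x then i else_) (ef v lt)) , es

AgreeBelow-↦₂ : ∀ {n B} {σ τ : Val n} X S → AgreeBelow B σ τ → AgreeBelow B (σ [ X ↦₂ S ]) (τ [ X ↦₂ S ])
AgreeBelow-↦₂ {B = B} {σ} {τ} X S (ef , es) = ef , agree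
  where
  agree : ∀ V → V < B → ∀ i → so (σ [ X ↦₂ S ]) V i ≡ so (τ [ X ↦₂ S ]) V i
  agree V lt i with V ≡ᵇ X
  ... | true  = refl
  ... | false = es V lt i

sat-coincide : ∀ {k n} (φ : Formula k) (w : Vec (Fin k) n) {σ τ : Val n} {B} →
  bound φ ≤ B → AgreeBelow B σ τ → sat w σ φ ≡ sat w τ φ
sat-coincide ⊤'       w le ag = refl
sat-coincide (P a x)  w le (ef , es) = cong (λ i → ⌊ lookup w i FinP.≟ a ⌋) (ef x le)
sat-coincide (x ≤' y) w le (ef , es) =
  cong₂ (λ i j → ⌊ i FinP.≤? j ⌋) (ef x (⊔-≤⁻ˡ (suc x) (suc y) le)) (ef y (⊔-≤⁻ʳ (suc x) (suc y) le))
sat-coincide (x ∈' X) w {σ} le (ef , es) =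
  trans (cong (so σ X) (ef x (⊔-≤⁻ˡ (suc x) (suc X) le))) (es X (⊔-≤⁻ʳ (suc x) (suc X) le) _)
sat-coincide (¬' φ)   w le ag = cong not (sat-coincide φ w le ag)
sat-coincide (φ ∧' ψ) w le ag =
  cong₂ _∧_ (sat-coincide φ w (⊔-≤⁻ˡ (bound φ) (bound ψ) le) ag)
            (sat-coincide ψ w (⊔-≤⁻ʳ (bound φ) (bound ψ) le) ag)
sat-coincide {n = n} (∀₁ x φ) w le ag =
  allB-cong (allFin n) (λ i → sat-coincide φ w (⊔-≤⁻ʳ (suc x) (bound φ) le) (AgreeBelow-↦₁ x i ag))
sat-coincide {n = n} (∀₂ X φ) w le ag =
  allB-cong (subsets n) (λ S → sat-coincide φ w (⊔-≤⁻ʳ (suc X) (bound φ) le) (AgreeBelow-↦₂ X S ag))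

sat-≗ : ∀ {k n} (φ : Formula k) (w : Vec (Fin k) n) {σ τ : Val n} →
  (∀ v → fo σ v ≡ fo τ v) → (∀ V i → so σ V i ≡ so τ V i) → sat w σ φ ≡ sat w τ φ
sat-≗ φ w ef es = sat-coincide φ w ℕP.≤-refl ((λ v _ → ef v) , (λ V _ → es V))

conj : ∀ {k} → List (Formula k) → Formula k
conj []      = ⊤'
conj (φ ∷ Δ) = φ ∧' conj Δ

sat-conj⁺ : ∀ {k n} Δ (w : Vec (Fin k) n) {σ} → Holds Δ w σ → sat w σ (conj Δ) ≡ true
sat-conj⁺ []      w []       = refl
sat-conj⁺ (φ ∷ Δ) w (h ∷ hs) rewrite h = sat-conj⁺ Δ w hs

sat-conj⁻ : ∀ {k n} Δ (w : Vec (Fin k) n) {σ} → sat w σ (conj Δ) ≡ true → Holds Δ w σ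
sat-conj⁻ []          w e = []
sat-conj⁻ (φ ∷ Δ) w {σ} e with sat w σ φ in eq
... | true = eq ∷ sat-conj⁻ Δ w e

bound-conj : ∀ {k} (Δ : List (Formula k)) → All (λ φ → bound φ ≤ bound (conj Δ)) Δ
bound-conj []      = []
bound-conj (φ ∷ Δ) = ℕP.m≤m⊔n (bound φ) _ ∷ All.map (λ le → ℕP.≤-trans le (ℕP.m≤n⊔m (bound φ) _)) (bound-conj Δ)

∃₁ : ∀ {k} → ℕ → Formula k → Formula k
∃₁ x φ = ¬' ∀₁ x (¬' φ)

∃₂ : ∀ {k} → ℕ → Formula k → Formula k
∃₂ X φ = ¬' ∀₂ X (¬' φ)

sat-∃₁⁻ : ∀ {k n} (w : Vec (Fin k) n) σ x φ → sat w σ (∃₁ x φ) ≡ true → ∃ λ i → sat w (σ [ x ↦₁ i ]) φ ≡ true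
sat-∃₁⁻ {n = n} w σ x φ e =
  let i , e′ = allB-false⁻ _ (allFin n) (not-flip e) in i , not-flip e′

sat-∃₁⁺ : ∀ {k n} (w : Vec (Fin k) n) σ x φ i → sat w (σ [ x ↦₁ i ]) φ ≡ true → sat w σ (∃₁ x φ) ≡ true
sat-∃₁⁺ w σ x φ i e = cong not (allB-false⁺ _ (∈-allFin i) (cong not e))

sat-∃₂⁻ : ∀ {k n} (w : Vec (Fin k) n) σ X φ → sat w σ (∃₂ X φ) ≡ true → ∃ λ S → sat w (σ [ X ↦₂ S ]) φ ≡ true
sat-∃₂⁻ {n = n} w σ X φ e =
  let S , e′ = allB-false⁻ _ (subsets n) (not-flip e) in S , not-flip e′

subsets-complete : ∀ n (S : Fin n → Bool) → ∃ λ S′ → S′ ∈ subsets n × (∀ i → S′ i ≡ S i)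
subsets-complete zero    S = _ , here refl , λ ()
subsets-complete (suc n) S =
  let S′ , S′∈ , S′≗ = subsets-complete n (λ i → S (suc i)) in
  consS (S zero) S′ ,
  ∈-concatMap⁺ (λ T → consS false T ∷ consS true T ∷ []) (Any.map (λ { refl → head∈ (S zero) S′ }) S′∈) ,
  agree S′ S′≗
  where
  head∈ : ∀ b (T : Fin n → Bool) → consS b T ∈ consS false T ∷ consS true T ∷ []
  head∈ false T = here refl
  head∈ true  T = there (here refl)
  agree : ∀ T → (∀ i → T i ≡ S (suc i)) → ∀ i → consS (S zero) T i ≡ S i
  agree T e zero    = refl
  agree T e (suc i) = e i

sat-∃₂⁺ : ∀ {k n} (w : Vec (Fin k) n) σ X φ S → sat w (σ [ X ↦₂ S ]) φ ≡ true → sat w σ (∃₂ X φ) ≡ true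
sat-∃₂⁺ {n = n} w σ X φ S e =
  let S′ , S′∈ , S′≗ = subsets-complete n S in
  cong not (allB-false⁺ _ S′∈ (cong not (trans (sat-≗ φ w (λ v → refl) (agree S′≗)) e)))
  where
  agree : ∀ {S′} → (∀ i → S′ i ≡ S i) → ∀ V i → so (σ [ X ↦₂ S′ ]) V i ≡ so (σ [ X ↦₂ S ]) V i
  agree S′≗ V i with V ≡ᵇ X
  ... | true  = S′≗ i
  ... | false = refl

∃-below : ∀ {k} → ℕ → Formula k → Formula k
∃-below zero    φ = φ
∃-below (suc b) φ = ∃-below b (∃₁ b (∃₂ b φ))

overwrite : ∀ {n} → ℕ → Val n → Val n → Val n
overwrite zero    σ τ = σ
overwrite (suc b) σ τ = ((overwrite b σ τ) [ b ↦₁ fo τ b ]) [ b ↦₂ so τ b ]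

overwrite-agrees : ∀ {n} B (σ τ : Val n) → AgreeBelow B (overwrite B σ τ) τ
overwrite-agrees zero    σ τ = (λ _ ()) , (λ _ ())
overwrite-agrees (suc b) σ τ = agreeFO , agreeSO
  where
  agreeFO : ∀ v → v < suc b → fo (overwrite (suc b) σ τ) v ≡ fo τ v
  agreeFO v (s≤s le) with v ≡ᵇ b in eq
  ... | true  = cong (fo τ) (sym (≡ᵇ-true⇒≡ v b eq))
  ... | false = proj₁ (overwrite-agrees b σ τ) v (ℕP.≤∧≢⇒< le (≡ᵇ-false⇒≢ eq))
  agreeSO : ∀ V → V < suc b → ∀ i → so (overwrite (suc b) σ τ) V i ≡ so τ V i
  agreeSO V (s≤s le) i with V ≡ᵇ b in eq
  ... | true  = cong (λ W → so τ W i) (sym (≡ᵇ-true⇒≡ V b eq))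
  ... | false = proj₂ (overwrite-agrees b σ τ) V (ℕP.≤∧≢⇒< le (≡ᵇ-false⇒≢ eq)) i

sat-∃-below⁻ : ∀ {k n} B (w : Vec (Fin k) n) σ φ → sat w σ (∃-below B φ) ≡ true → ∃ λ τ → sat w τ φ ≡ true
sat-∃-below⁻ zero    w σ φ e = σ , e
sat-∃-below⁻ (suc b) w σ φ e =
  let τ , e₁ = sat-∃-below⁻ b w σ (∃₁ b (∃₂ b φ)) e
      i , e₂ = sat-∃₁⁻ w τ b (∃₂ b φ) e₁
      S , e₃ = sat-∃₂⁻ w (τ [ b ↦₁ i ]) b φ e₂
  in _ , e₃

sat-∃-below⁺ : ∀ {k n} B (w : Vec (Fin k) n) σ τ φ → sat w (overwrite B σ τ) φ ≡ true → sat w σ (∃-below B φ) ≡ true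
sat-∃-below⁺ zero    w σ τ φ e = e
sat-∃-below⁺ (suc b) w σ τ φ e =
  sat-∃-below⁺ b w σ τ (∃₁ b (∃₂ b φ))
    (sat-∃₁⁺ w (overwrite b σ τ) b (∃₂ b φ) (fo τ b) (sat-∃₂⁺ w _ b φ (so τ b) e))

Satisfiable : ∀ {k} → List (Formula k) → Set
Satisfiable {k} Δ = ∃ λ m → ∃ λ (w : Vec (Fin k) (suc m)) → ∃ λ σ → Holds Δ w σ

σ₀ : ∀ {n} → Val (suc n)
σ₀ = record { fo = λ _ → zero ; so = λ _ _ → false }

-- Δ is satisfiable iff its existential closure holds under σ₀, which is what the automata decide.
closure : ∀ {k} → List (Formula k) → Formula k
closure Δ = ∃-below (bound (conj Δ)) (conj Δ)

closure⇒satisfiable : ∀ {k} (Δ : List (Formula k)) {m} (w : Vec (Fin k) (suc m)) →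
  sat w σ₀ (closure Δ) ≡ true → Satisfiable Δ
closure⇒satisfiable Δ w e =
  let τ , e′ = sat-∃-below⁻ (bound (conj Δ)) w σ₀ (conj Δ) e in _ , w , τ , sat-conj⁻ Δ w e′

satisfiable⇒closure : ∀ {k} (Δ : List (Formula k)) {m} (w : Vec (Fin k) (suc m)) σ →
  Holds Δ w σ → sat w σ₀ (closure Δ) ≡ true
satisfiable⇒closure Δ w σ h =
  sat-∃-below⁺ B w σ₀ σ (conj Δ)
    (trans (sat-coincide (conj Δ) w ℕP.≤-refl (overwrite-agrees B σ₀ σ)) (sat-conj⁺ Δ w h))
  where B = bound (conj Δ)

sat-substFO : ∀ {k n} (φ : Formula k) (w : Vec (Fin k) n) τ z x → bound φ ≤ z →
  sat w τ (substFO z x φ) ≡ sat w (τ [ x ↦₁ fo τ z ]) φ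
sat-substFO ⊤'       w τ z x le = refl
sat-substFO (P a y)  w τ z x le with y ≡ᵇ x
... | true  = refl
... | false = refl
sat-substFO (y ≤' y′) w τ z x le with y ≡ᵇ x | y′ ≡ᵇ x
... | true  | true  = refl
... | true  | false = refl
... | false | true  = refl
... | false | false = refl
sat-substFO (y ∈' X) w τ z x le with y ≡ᵇ x
... | true  = refl
... | false = refl
sat-substFO (¬' φ)   w τ z x le = cong not (sat-substFO φ w τ z x le)
sat-substFO (φ ∧' ψ) w τ z x le =
  cong₂ _∧_ (sat-substFO φ w τ z x (⊔-≤⁻ˡ (bound φ) (bound ψ) le))
            (sat-substFO ψ w τ z x (⊔-≤⁻ʳ (bound φ) (bound ψ) le))
sat-substFO {n = n} (∀₁ y φ) w τ z x le with y ≡ᵇ x in y≡x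
... | true  = allB-cong (allFin n) (λ i → sat-≗ φ w (shadowed i) (λ V i → refl))
  where
  shadowed : ∀ i v → fo (τ [ y ↦₁ i ]) v ≡ fo ((τ [ x ↦₁ fo τ z ]) [ y ↦₁ i ]) v
  shadowed i v with v ≡ᵇ y in v≡y
  ... | true  = refl
  ... | false with v ≡ᵇ x in v≡x
  ...   | false = refl
  ...   | true  = ⊥-elim (≡ᵇ-false⇒≢ v≡y (trans (≡ᵇ-true⇒≡ v x v≡x) (sym (≡ᵇ-true⇒≡ y x y≡x))))
... | false = allB-cong (allFin n) (λ i →
      trans (sat-substFO φ w (τ [ y ↦₁ i ]) z x (⊔-≤⁻ʳ (suc y) (bound φ) le))
            (sat-≗ φ w (commute i) (λ V i → refl)))
  where
  z≢y : (z ≡ᵇ y) ≡ false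
  z≢y = >⇒≡ᵇ-false (⊔-≤⁻ˡ (suc y) (bound φ) le)
  commute : ∀ i v → fo ((τ [ y ↦₁ i ]) [ x ↦₁ fo (τ [ y ↦₁ i ]) z ]) v ≡ fo ((τ [ x ↦₁ fo τ z ]) [ y ↦₁ i ]) v
  commute i v rewrite z≢y with v ≡ᵇ x in v≡x | v ≡ᵇ y in v≡y
  ... | true  | true  = ⊥-elim (≡ᵇ-false⇒≢ y≡x (trans (sym (≡ᵇ-true⇒≡ v y v≡y)) (≡ᵇ-true⇒≡ v x v≡x)))
  ... | true  | false = refl
  ... | false | true  = refl
  ... | false | false = refl
sat-substFO {n = n} (∀₂ X φ) w τ z x le =
  allB-cong (subsets n) (λ S → sat-substFO φ w (τ [ X ↦₂ S ]) z x (⊔-≤⁻ʳ (suc X) (bound φ) le))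

occursFO-bound : ∀ {k} (φ : Formula k) z → bound φ ≤ z → occursFO z φ ≡ false
occursFO-bound ⊤'        z le = refl
occursFO-bound (P a y)   z le = >⇒≡ᵇ-false le
occursFO-bound (y ≤' y′) z le
  rewrite >⇒≡ᵇ-false {z} {y} (⊔-≤⁻ˡ (suc y) (suc y′) le) | >⇒≡ᵇ-false {z} {y′} (⊔-≤⁻ʳ (suc y) (suc y′) le) = refl
occursFO-bound (y ∈' X)  z le = >⇒≡ᵇ-false (⊔-≤⁻ˡ (suc y) (suc X) le)
occursFO-bound (¬' φ)    z le = occursFO-bound φ z le
occursFO-bound (φ ∧' ψ)  z le
  rewrite occursFO-bound φ z (⊔-≤⁻ˡ (bound φ) (bound ψ) le) | occursFO-bound ψ z (⊔-≤⁻ʳ (bound φ) (bound ψ) le) = refl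
occursFO-bound (∀₁ y φ)  z le
  rewrite >⇒≡ᵇ-false {z} {y} (⊔-≤⁻ˡ (suc y) (bound φ) le) = occursFO-bound φ z (⊔-≤⁻ʳ (suc y) (bound φ) le)
occursFO-bound (∀₂ X φ)  z le = occursFO-bound φ z (⊔-≤⁻ʳ (suc X) (bound φ) le)

freeFO-bound : ∀ {k} (φ : Formula k) z → bound φ ≤ z → freeFO z φ ≡ false
freeFO-bound ⊤'        z le = refl
freeFO-bound (P a y)   z le = >⇒≡ᵇ-false le
freeFO-bound (y ≤' y′) z le
  rewrite >⇒≡ᵇ-false {z} {y} (⊔-≤⁻ˡ (suc y) (suc y′) le) | >⇒≡ᵇ-false {z} {y′} (⊔-≤⁻ʳ (suc y) (suc y′) le) = refl
freeFO-bound (y ∈' X)  z le = >⇒≡ᵇ-false (⊔-≤⁻ˡ (suc y) (suc X) le)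
freeFO-bound (¬' φ)    z le = freeFO-bound φ z le
freeFO-bound (φ ∧' ψ)  z le
  rewrite freeFO-bound φ z (⊔-≤⁻ˡ (bound φ) (bound ψ) le) | freeFO-bound ψ z (⊔-≤⁻ʳ (bound φ) (bound ψ) le) = refl
freeFO-bound (∀₁ y φ)  z le rewrite freeFO-bound φ z (⊔-≤⁻ʳ (suc y) (bound φ) le) = BP.∧-zeroʳ _
freeFO-bound (∀₂ X φ)  z le = freeFO-bound φ z (⊔-≤⁻ʳ (suc X) (bound φ) le)

sat-∃₁-↦₁ : ∀ {k n} (w : Vec (Fin k) n) σ z i φ → sat w (σ [ z ↦₁ i ]) (∃₁ z φ) ≡ sat w σ (∃₁ z φ)
sat-∃₁-↦₁ {n = n} w σ z i φ =
  cong not (allB-cong (allFin n) (λ j → cong not (sat-≗ φ w (overridden j) (λ V i → refl))))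
  where
  overridden : ∀ j v → fo ((σ [ z ↦₁ i ]) [ z ↦₁ j ]) v ≡ fo (σ [ z ↦₁ j ]) v
  overridden j v with v ≡ᵇ z
  ... | true  = refl
  ... | false = refl

↦₁-self : ∀ {n} (σ : Val n) z v → fo (σ [ z ↦₁ fo σ z ]) v ≡ fo σ v
↦₁-self σ z v with v ≡ᵇ z in v≡z
... | true  = cong (fo σ) (sym (≡ᵇ-true⇒≡ v z v≡z))
... | false = refl

boundStep : ∀ {k R} → Step k R → ℕ
boundStep (wt r)          = 0
boundStep (cond φ Ψ₁ Ψ₂) = bound φ ⊔ (boundStep Ψ₁ ⊔ boundStep Ψ₂)

module _ {k R} (φ : Formula k) (Ψ₁ Ψ₂ : Step k R) {B} (le : boundStep (cond φ Ψ₁ Ψ₂) ≤ B) where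
  bound-cond : bound φ ≤ B
  bound-cond = ⊔-≤⁻ˡ (bound φ) _ le
  bound-then : boundStep Ψ₁ ≤ B
  bound-then = ⊔-≤⁻ˡ (boundStep Ψ₁) (boundStep Ψ₂) (⊔-≤⁻ʳ (bound φ) _ le)
  bound-else : boundStep Ψ₂ ≤ B
  bound-else = ⊔-≤⁻ʳ (boundStep Ψ₁) (boundStep Ψ₂) (⊔-≤⁻ʳ (bound φ) _ le)

⟦cond⟧-then : ∀ {k R n} φ (Ψ₁ Ψ₂ : Step k R) {w : Vec (Fin k) n} {τ} →
  sat w τ φ ≡ true → ⟦ cond φ Ψ₁ Ψ₂ ⟧ˢ w τ ≡ ⟦ Ψ₁ ⟧ˢ w τ
⟦cond⟧-then φ Ψ₁ Ψ₂ h rewrite h = refl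

⟦cond⟧-else : ∀ {k R n} φ (Ψ₁ Ψ₂ : Step k R) {w : Vec (Fin k) n} {τ} →
  sat w τ (¬' φ) ≡ true → ⟦ cond φ Ψ₁ Ψ₂ ⟧ˢ w τ ≡ ⟦ Ψ₂ ⟧ˢ w τ
⟦cond⟧-else φ Ψ₁ Ψ₂ h rewrite not-flip h = refl

⟦⟧ˢ-coincide : ∀ {k R n} (Ψ : Step k R) (w : Vec (Fin k) n) {σ τ B} → boundStep Ψ ≤ B → AgreeBelow B σ τ →
  ⟦ Ψ ⟧ˢ w σ ≡ ⟦ Ψ ⟧ˢ w τ
⟦⟧ˢ-coincide (wt r)          w le ag = refl
⟦⟧ˢ-coincide (cond φ Ψ₁ Ψ₂) w le ag
  rewrite sat-coincide φ w (bound-cond φ Ψ₁ Ψ₂ le) ag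
        | ⟦⟧ˢ-coincide Ψ₁ w (bound-then φ Ψ₁ Ψ₂ le) ag
        | ⟦⟧ˢ-coincide Ψ₂ w (bound-else φ Ψ₁ Ψ₂ le) ag = refl

⟦⟧ˢ-substStep : ∀ {k R n} (Ψ : Step k R) (w : Vec (Fin k) n) τ z x → boundStep Ψ ≤ z →
  ⟦ substStep z x Ψ ⟧ˢ w τ ≡ ⟦ Ψ ⟧ˢ w (τ [ x ↦₁ fo τ z ])
⟦⟧ˢ-substStep (wt r)          w τ z x le = refl
⟦⟧ˢ-substStep (cond φ Ψ₁ Ψ₂) w τ z x le
  rewrite sat-substFO φ w τ z x (bound-cond φ Ψ₁ Ψ₂ le)
        | ⟦⟧ˢ-substStep Ψ₁ w τ z x (bound-then φ Ψ₁ Ψ₂ le)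
        | ⟦⟧ˢ-substStep Ψ₂ w τ z x (bound-else φ Ψ₁ Ψ₂ le) = refl

occursStep-bound : ∀ {k R} (Ψ : Step k R) z → boundStep Ψ ≤ z → occursStep z Ψ ≡ false
occursStep-bound (wt r)          z le = refl
occursStep-bound (cond φ Ψ₁ Ψ₂) z le
  rewrite occursFO-bound φ z (bound-cond φ Ψ₁ Ψ₂ le)
        | occursStep-bound Ψ₁ z (bound-then φ Ψ₁ Ψ₂ le)
        | occursStep-bound Ψ₂ z (bound-else φ Ψ₁ Ψ₂ le) = refl

⟦⟧ˢ-rename : ∀ {k R n} (Ψ : Step k R) (w : Vec (Fin k) n) σ z x i → boundStep Ψ ≤ z →
  ⟦ substStep z x Ψ ⟧ˢ w (σ [ z ↦₁ i ]) ≡ ⟦ Ψ ⟧ˢ w (σ [ x ↦₁ i ])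
⟦⟧ˢ-rename Ψ w σ z x i le =
  trans (⟦⟧ˢ-substStep Ψ w (σ [ z ↦₁ i ]) z x le) (⟦⟧ˢ-coincide Ψ w le (agreeFO , λ V _ _ → refl))
  where
  agreeFO : ∀ v → v < z → fo ((σ [ z ↦₁ i ]) [ x ↦₁ fo (σ [ z ↦₁ i ]) z ]) v ≡ fo (σ [ x ↦₁ i ]) v
  agreeFO v lt rewrite ≡ᵇ-refl z with v ≡ᵇ x
  ... | true  = refl
  ... | false rewrite <⇒≡ᵇ-false lt = refl

-- Automata deciding satisfiability

-- A state reaches a final state iff it does so by a word of length at most
-- the number of states (pigeonhole), which makes reachability decidable.
module Reachability {k} {S : Set} (finite : Finite S) (step : S → Fin k → S) (final : S → Bool) where
  open Finite finite

  run : S → List (Fin k) → S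
  run = foldl step

  reachableWithin : ℕ → S → Bool
  reachableWithin zero    s = final s
  reachableWithin (suc l) s = final s ∨ anyF (λ a → reachableWithin l (step s a))

  reachableWithin-sound : ∀ l s → reachableWithin l s ≡ true → ∃ λ as → final (run s as) ≡ true
  reachableWithin-sound zero    s e = [] , e
  reachableWithin-sound (suc l) s e with final s in eq
  ... | true  = [] , eq
  ... | false =
    let a , e′ = anyF-true⁻ (λ a → reachableWithin l (step s a)) e
        as , e″ = reachableWithin-sound l (step s a) e′
    in a ∷ as , e″

  reachableWithin-complete : ∀ l s as → length as ≤ l → final (run s as) ≡ true → reachableWithin l s ≡ true
  reachableWithin-complete zero    s []       le       e = e
  reachableWithin-complete (suc l) s []       le       e rewrite e = refl
  reachableWithin-complete (suc l) s (a ∷ as) (s≤s le) e =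
    trans (cong (final s ∨_) (anyF-true⁺ _ a (reachableWithin-complete l (step s a) as le e))) (BP.∨-zeroʳ _)

  run-cut : ∀ s as i j → run s (take i as) ≡ run s (take j as) → run s (take i as ++ drop j as) ≡ run s as
  run-cut s as i j loop = begin
    run s (take i as ++ drop j as)       ≡⟨ LP.foldl-++ step s (take i as) (drop j as) ⟩
    run (run s (take i as)) (drop j as)  ≡⟨ cong (λ t → run t (drop j as)) loop ⟩
    run (run s (take j as)) (drop j as)  ≡⟨ LP.foldl-++ step s (take j as) (drop j as) ⟨
    run s (take j as ++ drop j as)       ≡⟨ cong (run s) (LP.take++drop≡id j as) ⟩
    run s as                             ∎
    where open ≡-Reasoning

  length-cut : ∀ (as : List (Fin k)) {i j} → i < j → j ≤ length as → length (take i as ++ drop j as) < length as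
  length-cut as {i} {j} i<j j≤len = begin-strict
    length (take i as ++ drop j as)          ≡⟨ LP.length-++ (take i as) ⟩
    length (take i as) + length (drop j as)  ≡⟨ cong₂ _+_ (LP.length-take i as) (LP.length-drop j as) ⟩
    i ⊓ length as + (length as ∸ j)          ≡⟨ cong (_+ (length as ∸ j)) (ℕP.m≤n⇒m⊓n≡m i≤len) ⟩
    i + (length as ∸ j)                      <⟨ ℕP.+-monoˡ-< (length as ∸ j) i<j ⟩
    j + (length as ∸ j)                      ≡⟨ ℕP.m+[n∸m]≡n j≤len ⟩
    length as                                ∎
    where
    open ℕP.≤-Reasoning
    i≤len = ℕP.≤-trans (ℕP.<⇒≤ i<j) j≤len

  shorten : ∀ fuel s as → length as ≤ fuel → ∃ λ as′ → length as′ ≤ size × run s as′ ≡ run s as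
  shorten zero    s []  le = [] , z≤n , refl
  shorten (suc fuel) s as le with length as ℕ.≤? size
  ... | yes short = as , short , refl
  ... | no  long  =
    let i , j , i<j , same = FinP.pigeonhole (ℕP.n<1+n size) (λ t → index (run s (take (toℕ t) as)))
        j≤len = ℕP.≤-trans (ℕP.≤-pred (FinP.toℕ<n j)) (ℕP.<⇒≤ (ℕP.≰⇒> long))
        as′ , short , e = shorten fuel s (take (toℕ i) as ++ drop (toℕ j) as)
                            (ℕP.≤-pred (ℕP.≤-trans (length-cut as i<j j≤len) le))
    in as′ , short , trans e (run-cut s as (toℕ i) (toℕ j) (index-injective _ _ same))

  reachable? : ∀ s → Dec (∃ λ as → final (run s as) ≡ true)
  reachable? s with reachableWithin size s in eq
  ... | true  = yes (reachableWithin-sound size s eq)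
  ... | false = no λ (as , e) →
    let as′ , short , e′ = shorten (length as) s as ℕP.≤-refl in
    false≢true (trans (sym eq) (reachableWithin-complete size s as′ short (trans (cong final e′) e)))

module Automata (k : ℕ) where

  -- The letter at a position records the symbol and which variables of either sort point to it.
  record Letter : Set where
    constructor mkLetter
    field
      symbol : Fin k
      atFO   : ℕ → Bool
      inSO   : ℕ → Bool
  open Letter public

  _≈L_ : Letter → Letter → Set
  c ≈L d = (symbol c ≡ symbol d) × (∀ v → atFO c v ≡ atFO d v) × (∀ V → inSO c V ≡ inSO d V)

  letter : ∀ {n} → Vec (Fin k) n → Val n → Fin n → Letter
  letter w σ p = mkLetter (lookup w p) (λ v → eqF (fo σ v) p) (λ V → so σ V p)

  letters : ∀ {n} → Vec (Fin k) n → Val n → List Letter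
  letters w σ = tabulate (letter w σ)

  setFO : ℕ → Bool → Letter → Letter
  setFO x b c = mkLetter (symbol c) (λ v → if v ≡ᵇ x then b else atFO c v) (inSO c)

  setSO : ℕ → Bool → Letter → Letter
  setSO X b c = mkLetter (symbol c) (atFO c) (λ V → if V ≡ᵇ X then b else inSO c V)

  setFO-≈ : ∀ x b {c d} → c ≈L d → setFO x b c ≈L setFO x b d
  setFO-≈ x b (e₁ , e₂ , e₃) = e₁ , (λ v → cong (if v ≡ᵇ x then b else_) (e₂ v)) , e₃

  setSO-≈ : ∀ X b {c d} → c ≈L d → setSO X b c ≈L setSO X b d
  setSO-≈ X b (e₁ , e₂ , e₃) = e₁ , e₂ , (λ V → cong (if V ≡ᵇ X then b else_) (e₃ V))

  record DFA : Set₁ where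
    field
      State  : Set
      finite : Finite State
      step   : State → Letter → State
      step-≈ : ∀ s {c d} → c ≈L d → step s c ≡ step s d
      start  : State
      final  : State → Bool

  accepts : DFA → List Letter → Bool
  accepts A cs = final (foldl step start cs)
    where open DFA A

  foldl-≈ : ∀ (A : DFA) {n} (f g : Fin n → Letter) → (∀ p → f p ≈L g p) → ∀ s →
    foldl (DFA.step A) s (tabulate f) ≡ foldl (DFA.step A) s (tabulate g)
  foldl-≈ A {zero}  f g e s = refl
  foldl-≈ A {suc n} f g e s rewrite DFA.step-≈ A s (e zero) =
    foldl-≈ A (λ p → f (suc p)) (λ p → g (suc p)) (λ p → e (suc p)) _

  accepts-≈ : ∀ (A : DFA) {n} (f g : Fin n → Letter) → (∀ p → f p ≈L g p) →
    accepts A (tabulate f) ≡ accepts A (tabulate g)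
  accepts-≈ A f g e = cong (DFA.final A) (foldl-≈ A f g e (DFA.start A))

  complement : DFA → DFA
  complement A = record { DFA A ; final = λ s → not (DFA.final A s) }

  product : DFA → DFA → DFA
  product A B = record
    { State  = A.State × B.State
    ; finite = finite-× A.finite B.finite
    ; step   = λ (s , t) c → A.step s c , B.step t c
    ; step-≈ = λ (s , t) e → cong₂ _,_ (A.step-≈ s e) (B.step-≈ t e)
    ; start  = A.start , B.start
    ; final  = λ (s , t) → A.final s ∧ B.final t
    }
    where
    module A = DFA A
    module B = DFA B

  accepts-product : ∀ A B cs → accepts (product A B) cs ≡ accepts A cs ∧ accepts B cs
  accepts-product A B cs = cong (λ (s , t) → DFA.final A s ∧ DFA.final B t) (run _ _ cs)
    where
    run : ∀ s t cs → foldl (DFA.step (product A B)) (s , t) cs ≡ (foldl (DFA.step A) s cs , foldl (DFA.step B) t cs)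
    run s t []       = refl
    run s t (c ∷ cs) = run _ _ cs

  someLetter : (g : Letter → Bool) → (∀ {c d} → c ≈L d → g c ≡ g d) → DFA
  someLetter g g-≈ = record
    { State = Bool ; finite = finite-Bool ; step = λ b c → b ∨ g c ; step-≈ = λ b e → cong (b ∨_) (g-≈ e)
    ; start = false ; final = λ b → b }

  accepts-someLetter : ∀ g (g-≈ : ∀ {c d} → c ≈L d → g c ≡ g d) {n} (f : Fin n → Letter) →
    accepts (someLetter g g-≈) (tabulate f) ≡ anyF (λ p → g (f p))
  accepts-someLetter g g-≈ f = run f false
    where
    run : ∀ {n} (f : Fin n → Letter) b → foldl (λ b c → b ∨ g c) b (tabulate f) ≡ b ∨ anyF (λ p → g (f p))
    run {zero}  f b = sym (BP.∨-identityʳ b)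
    run {suc n} f b = trans (run (λ p → f (suc p)) (b ∨ g (f zero))) (BP.∨-assoc b _ _)

  record NFA : Set₁ where
    field
      State  : Set
      finite : Finite State
      next   : State → Letter → List State
      next-≈ : ∀ s {c d} → c ≈L d → next s c ≡ next s d
      start  : List State
      final  : State → Bool

  acceptsFrom : (N : NFA) → NFA.State N → List Letter → Bool
  acceptsFrom N s []       = NFA.final N s
  acceptsFrom N s (c ∷ cs) = any (λ s′ → acceptsFrom N s′ cs) (NFA.next N s c)

  -- The subset construction: a set of states is its characteristic vector over the indices.
  module SubsetConstruction (N : NFA) where
    open NFA N
    open Finite finite

    hits : Fin size → List State → Bool
    hits i l = any (λ s → eqF (index s) i) l

    any-hits : ∀ (G : State → Bool) (l : List State) → anyF (λ i → hits i l ∧ G (element i)) ≡ any G l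
    any-hits G []      = anyF-false size
    any-hits G (s ∷ l) =
      trans (anyF-cong (λ i → BP.∧-distribʳ-∨ (G (element i)) (eqF (index s) i) (hits i l)))
      (trans (anyF-∨ (λ i → eqF (index s) i ∧ G (element i)) (λ i → hits i l ∧ G (element i)))
      (cong₂ _∨_ (trans (anyF-eqF (index s) (λ i → G (element i))) (cong G (element-index s))) (any-hits G l)))

    dstep : Vec Bool size → Letter → Vec Bool size
    dstep v c = V.tabulate (λ j → anyF (λ i → lookup v i ∧ hits j (next (element i) c)))

    dfinal : Vec Bool size → Bool
    dfinal v = anyF (λ i → lookup v i ∧ final (element i))

    dfinal-foldl : ∀ v cs → dfinal (foldl dstep v cs) ≡ anyF (λ i → lookup v i ∧ acceptsFrom N (element i) cs)
    dfinal-foldl v []       = refl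
    dfinal-foldl v (c ∷ cs) = begin
      dfinal (foldl dstep (dstep v c) cs)
        ≡⟨ dfinal-foldl (dstep v c) cs ⟩
      anyF (λ j → lookup (dstep v c) j ∧ acc j)
        ≡⟨ anyF-cong (λ j → trans (cong (_∧ acc j) (VP.lookup∘tabulate _ j))
                                  (sym (anyF-∧ʳ (λ i → lookup v i ∧ hits j (succ i)) (acc j)))) ⟩
      anyF (λ j → anyF (λ i → (lookup v i ∧ hits j (succ i)) ∧ acc j))
        ≡⟨ anyF-comm (λ j i → (lookup v i ∧ hits j (succ i)) ∧ acc j) ⟩
      anyF (λ i → anyF (λ j → (lookup v i ∧ hits j (succ i)) ∧ acc j))
        ≡⟨ anyF-cong (λ i → trans (anyF-cong (λ j → BP.∧-assoc (lookup v i) (hits j (succ i)) (acc j)))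
                                  (anyF-∧ˡ (lookup v i) (λ j → hits j (succ i) ∧ acc j))) ⟩
      anyF (λ i → lookup v i ∧ anyF (λ j → hits j (succ i) ∧ acc j))
        ≡⟨ anyF-cong (λ i → cong (lookup v i ∧_) (any-hits (λ s → acceptsFrom N s cs) (succ i))) ⟩
      anyF (λ i → lookup v i ∧ acceptsFrom N (element i) (c ∷ cs))
        ∎
      where
      open ≡-Reasoning
      succ : Fin size → List State
      succ i = next (element i) c
      acc : Fin size → Bool
      acc j = acceptsFrom N (element j) cs

    dfa : DFA
    dfa = record
      { State  = Vec Bool size
      ; finite = finite-Vec-Bool size
      ; step   = dstep
      ; step-≈ = λ v e → VP.tabulate-cong (λ j → anyF-cong (λ i →
                   cong (λ l → lookup v i ∧ hits j l) (next-≈ (element i) e)))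
      ; start  = V.tabulate (λ j → hits j start)
      ; final  = dfinal
      }

    accepts-dfa : ∀ cs → accepts dfa cs ≡ any (λ s → acceptsFrom N s cs) start
    accepts-dfa cs =
      trans (dfinal-foldl _ cs)
      (trans (anyF-cong (λ i → cong (_∧ acceptsFrom N (element i) cs) (VP.lookup∘tabulate _ i)))
             (any-hits (λ s → acceptsFrom N s cs) start))

  determinise : NFA → DFA
  determinise = SubsetConstruction.dfa

  accepts-determinise : ∀ N cs → accepts (determinise N) cs ≡ any (λ s → acceptsFrom N s cs) (NFA.start N)
  accepts-determinise = SubsetConstruction.accepts-dfa

  letter-↦₁ : ∀ {n} (w : Vec (Fin k) n) σ x i p → setFO x (eqF i p) (letter w σ p) ≈L letter w (σ [ x ↦₁ i ]) p
  letter-↦₁ w σ x i p = refl , atFO-≡ , λ V → refl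
    where
    atFO-≡ : ∀ v → (if v ≡ᵇ x then eqF i p else eqF (fo σ v) p) ≡ eqF (fo (σ [ x ↦₁ i ]) v) p
    atFO-≡ v with v ≡ᵇ x
    ... | true  = refl
    ... | false = refl

  letter-↦₂ : ∀ {n} (w : Vec (Fin k) n) σ X S p → setSO X (S p) (letter w σ p) ≈L letter w (σ [ X ↦₂ S ]) p
  letter-↦₂ w σ X S p = refl , (λ v → refl) , inSO-≡
    where
    inSO-≡ : ∀ V → (if V ≡ᵇ X then S p else so σ V p) ≡ so (σ [ X ↦₂ S ]) V p
    inSO-≡ V with V ≡ᵇ X
    ... | true  = refl
    ... | false = refl

  -- Guess the position of x: the flag records whether it has been placed.
  projectFO : ℕ → DFA → NFA
  projectFO x A = record
    { State  = A.State × Bool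
    ; finite = finite-× A.finite finite-Bool
    ; next   = next
    ; next-≈ = next-≈
    ; start  = (A.start , false) ∷ []
    ; final  = λ (s , placed) → placed ∧ A.final s
    }
    where
    module A = DFA A
    next : A.State × Bool → Letter → List (A.State × Bool)
    next (s , false) c = (A.step s (setFO x true c) , true) ∷ (A.step s (setFO x false c) , false) ∷ []
    next (s , true)  c = (A.step s (setFO x false c) , true) ∷ []
    next-≈ : ∀ s {c d} → c ≈L d → next s c ≡ next s d
    next-≈ (s , false) e rewrite A.step-≈ s (setFO-≈ x true e) | A.step-≈ s (setFO-≈ x false e) = refl
    next-≈ (s , true)  e rewrite A.step-≈ s (setFO-≈ x false e) = refl

  acceptsFrom-projectFO : ∀ x A {n} (f : Fin n → Letter) s →
    acceptsFrom (projectFO x A) (s , false) (tabulate f)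
      ≡ anyF (λ i → DFA.final A (foldl (DFA.step A) s (tabulate (λ p → setFO x (eqF i p) (f p)))))
  acceptsFrom-projectFO x A {zero}  f s = refl
  acceptsFrom-projectFO x A {suc n} f s =
    cong₂ _∨_ (placed (λ p → f (suc p)) _) (trans (BP.∨-identityʳ _) (acceptsFrom-projectFO x A (λ p → f (suc p)) _))
    where
    placed : ∀ {n} (f : Fin n → Letter) s →
      acceptsFrom (projectFO x A) (s , true) (tabulate f)
        ≡ DFA.final A (foldl (DFA.step A) s (tabulate (λ p → setFO x false (f p))))
    placed {zero}  f s = refl
    placed {suc n} f s = trans (BP.∨-identityʳ _) (placed (λ p → f (suc p)) _)

  accepts-projectFO : ∀ x A {n} (w : Vec (Fin k) n) σ →
    accepts (determinise (projectFO x A)) (letters w σ) ≡ anyF (λ i → accepts A (letters w (σ [ x ↦₁ i ])))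
  accepts-projectFO x A w σ =
    trans (accepts-determinise (projectFO x A) (letters w σ))
    (trans (BP.∨-identityʳ _)
    (trans (acceptsFrom-projectFO x A (letter w σ) _)
           (anyF-cong (λ i → accepts-≈ A _ _ (letter-↦₁ w σ x i)))))

  projectSO : ℕ → DFA → NFA
  projectSO X A = record
    { State  = A.State
    ; finite = A.finite
    ; next   = λ s c → A.step s (setSO X false c) ∷ A.step s (setSO X true c) ∷ []
    ; next-≈ = λ s e → cong₂ (λ a b → a ∷ b ∷ []) (A.step-≈ s (setSO-≈ X false e)) (A.step-≈ s (setSO-≈ X true e))
    ; start  = A.start ∷ []
    ; final  = A.final
    }
    where module A = DFA A

  acceptsFrom-projectSO : ∀ X A {n} (f : Fin n → Letter) s →
    acceptsFrom (projectSO X A) s (tabulate f)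
      ≡ any (λ S → DFA.final A (foldl (DFA.step A) s (tabulate (λ p → setSO X (S p) (f p))))) (subsets n)
  acceptsFrom-projectSO X A {zero}  f s = sym (BP.∨-identityʳ _)
  acceptsFrom-projectSO X A {suc n} f s = begin
    acceptsFrom (projectSO X A) _ (tabulate (λ p → f (suc p)))
      ∨ (acceptsFrom (projectSO X A) _ (tabulate (λ p → f (suc p))) ∨ false)
      ≡⟨ cong₂ _∨_ (acceptsFrom-projectSO X A (λ p → f (suc p)) _)
                   (trans (BP.∨-identityʳ _) (acceptsFrom-projectSO X A (λ p → f (suc p)) _)) ⟩
    any (λ S → G (consS false S)) (subsets n) ∨ any (λ S → G (consS true S)) (subsets n)
      ≡⟨ sym (any-∨ (λ S → G (consS false S)) (λ S → G (consS true S)) (subsets n)) ⟩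
    any (λ S → G (consS false S) ∨ G (consS true S)) (subsets n)
      ≡⟨ any-cong (subsets n) (λ S → cong (G (consS false S) ∨_) (sym (BP.∨-identityʳ (G (consS true S))))) ⟩
    any (λ S → any G (consS false S ∷ consS true S ∷ [])) (subsets n)
      ≡⟨ sym (any-concatMap G (λ S → consS false S ∷ consS true S ∷ []) (subsets n)) ⟩
    any G (subsets (suc n))
      ∎
    where
    open ≡-Reasoning
    G : (Fin (suc n) → Bool) → Bool
    G S = DFA.final A (foldl (DFA.step A) s (tabulate (λ p → setSO X (S p) (f p))))

  accepts-projectSO : ∀ X A {n} (w : Vec (Fin k) n) σ →
    accepts (determinise (projectSO X A)) (letters w σ) ≡ any (λ S → accepts A (letters w (σ [ X ↦₂ S ]))) (subsets n)
  accepts-projectSO X A {n} w σ =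
    trans (accepts-determinise (projectSO X A) (letters w σ))
    (trans (BP.∨-identityʳ _)
    (trans (acceptsFrom-projectSO X A (letter w σ) _)
           (any-cong (subsets n) (λ S → accepts-≈ A _ _ (letter-↦₂ w σ X S)))))

  -- The flag s records that x has been seen, r that y has been seen at or after x.
  leqStep : ℕ → ℕ → Bool × Bool → Letter → Bool × Bool
  leqStep x y (s , r) c = s ∨ atFO c x , r ∨ (atFO c y ∧ (s ∨ atFO c x))

  leqAutomaton : ℕ → ℕ → DFA
  leqAutomaton x y = record
    { State  = Bool × Bool
    ; finite = finite-× finite-Bool finite-Bool
    ; step   = leqStep x y
    ; step-≈ = λ (s , r) (_ , e , _) → cong₂ (λ a b → s ∨ a , r ∨ (b ∧ (s ∨ a))) (e x) (e y)
    ; start  = false , false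
    ; final  = proj₂
    }

  leqStep-found : ∀ x y s cs → proj₂ (foldl (leqStep x y) (s , true) cs) ≡ true
  leqStep-found x y s []       = refl
  leqStep-found x y s (c ∷ cs) = leqStep-found x y _ cs

  leqStep-no-y : ∀ x y {n} (f : Fin n → Letter) → (∀ p → atFO (f p) y ≡ false) → ∀ s r →
    proj₂ (foldl (leqStep x y) (s , r) (tabulate f)) ≡ r
  leqStep-no-y x y {zero}  f hy s r = refl
  leqStep-no-y x y {suc n} f hy s r rewrite hy zero =
    trans (leqStep-no-y x y (λ p → f (suc p)) (λ p → hy (suc p)) _ (r ∨ false)) (BP.∨-identityʳ r)

  leqStep-y-only : ∀ x y {n} (f : Fin n → Letter) j → (∀ p → atFO (f p) x ≡ false) → (∀ p → atFO (f p) y ≡ eqF j p) →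
    ∀ s r → proj₂ (foldl (leqStep x y) (s , r) (tabulate f)) ≡ r ∨ s
  leqStep-y-only x y {suc n} f zero    hx hy s r rewrite hx zero | hy zero =
    trans (leqStep-no-y x y (λ p → f (suc p)) (λ p → hy (suc p)) _ _) (cong (r ∨_) (BP.∨-identityʳ s))
  leqStep-y-only x y {suc n} f (suc j) hx hy s r rewrite hx zero | hy zero =
    trans (leqStep-y-only x y (λ p → f (suc p)) j (λ p → hx (suc p)) (λ p → hy (suc p)) _ _)
          (cong₂ _∨_ (BP.∨-identityʳ r) (BP.∨-identityʳ s))

  leqF : ∀ {n} → Fin n → Fin n → Bool
  leqF zero    j       = true
  leqF (suc i) zero    = false
  leqF (suc i) (suc j) = leqF i j

  leqF-≤ : ∀ {n} {i j : Fin n} → toℕ i ≤ toℕ j → leqF i j ≡ true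
  leqF-≤ {i = zero}          _        = refl
  leqF-≤ {i = suc i} {suc j} (s≤s le) = leqF-≤ le

  leqF-≰ : ∀ {n} {i j : Fin n} → ¬ toℕ i ≤ toℕ j → leqF i j ≡ false
  leqF-≰ {i = zero}          nle = ⊥-elim (nle z≤n)
  leqF-≰ {i = suc i} {zero}  nle = refl
  leqF-≰ {i = suc i} {suc j} nle = leqF-≰ (λ le → nle (s≤s le))

  leqF≡≤? : ∀ {n} (i j : Fin n) → leqF i j ≡ ⌊ i FinP.≤? j ⌋
  leqF≡≤? i j with i FinP.≤? j
  ... | yes le  = leqF-≤ le
  ... | no  nle = leqF-≰ nle

  leqStep-correct : ∀ x y {n} (f : Fin n → Letter) i j →
    (∀ p → atFO (f p) x ≡ eqF i p) → (∀ p → atFO (f p) y ≡ eqF j p) →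
    ∀ s r → proj₂ (foldl (leqStep x y) (s , r) (tabulate f)) ≡ r ∨ (s ∨ leqF i j)
  leqStep-correct x y {suc n} f zero zero hx hy s r rewrite hx zero | hy zero | BP.∨-zeroʳ s | BP.∨-zeroʳ r =
    leqStep-found x y true (tabulate (λ p → f (suc p)))
  leqStep-correct x y {suc n} f zero (suc j) hx hy s r rewrite hx zero | hy zero | BP.∨-zeroʳ s | BP.∨-zeroʳ r =
    trans (leqStep-y-only x y (λ p → f (suc p)) j (λ p → hx (suc p)) (λ p → hy (suc p)) true (r ∨ false))
          (BP.∨-zeroʳ (r ∨ false))
  leqStep-correct x y {suc n} f (suc i) zero hx hy s r rewrite hx zero | hy zero =
    trans (leqStep-no-y x y (λ p → f (suc p)) (λ p → hy (suc p)) _ _)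
          (cong (r ∨_) (trans (BP.∨-identityʳ s) (sym (BP.∨-identityʳ s))))
  leqStep-correct x y {suc n} f (suc i) (suc j) hx hy s r rewrite hx zero | hy zero =
    trans (leqStep-correct x y (λ p → f (suc p)) i j (λ p → hx (suc p)) (λ p → hy (suc p)) _ _)
          (cong₂ (λ a b → a ∨ (b ∨ leqF i j)) (BP.∨-identityʳ r) (BP.∨-identityʳ s))

  symbolAt : Fin k → ℕ → Letter → Bool
  symbolAt a x c = atFO c x ∧ ⌊ symbol c FinP.≟ a ⌋

  symbolAt-≈ : ∀ a x {c d} → c ≈L d → symbolAt a x c ≡ symbolAt a x d
  symbolAt-≈ a x (e₁ , e₂ , _) = cong₂ (λ u v → u ∧ ⌊ v FinP.≟ a ⌋) (e₂ x) e₁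

  memberAt : ℕ → ℕ → Letter → Bool
  memberAt x X c = atFO c x ∧ inSO c X

  memberAt-≈ : ∀ x X {c d} → c ≈L d → memberAt x X c ≡ memberAt x X d
  memberAt-≈ x X (_ , e₂ , e₃) = cong₂ _∧_ (e₂ x) (e₃ X)

  trueAutomaton : DFA
  trueAutomaton = record
    { State = ⊤ ; finite = finite-⊤ ; step = λ _ _ → tt ; step-≈ = λ _ _ → refl ; start = tt ; final = λ _ → true }

  automaton : Formula k → DFA
  automaton ⊤'       = trueAutomaton
  automaton (P a x)  = someLetter (symbolAt a x) (symbolAt-≈ a x)
  automaton (x ≤' y) = leqAutomaton x y
  automaton (x ∈' X) = someLetter (memberAt x X) (memberAt-≈ x X)
  automaton (¬' φ)   = complement (automaton φ)
  automaton (φ ∧' ψ) = product (automaton φ) (automaton ψ)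
  automaton (∀₁ x φ) = complement (determinise (projectFO x (complement (automaton φ))))
  automaton (∀₂ X φ) = complement (determinise (projectSO X (complement (automaton φ))))

  accepts-automaton : ∀ φ {n} (w : Vec (Fin k) n) σ → accepts (automaton φ) (letters w σ) ≡ sat w σ φ
  accepts-automaton ⊤'       w σ = refl
  accepts-automaton (P a x)  w σ =
    trans (accepts-someLetter (symbolAt a x) (symbolAt-≈ a x) (letter w σ))
          (anyF-eqF (fo σ x) (λ p → ⌊ lookup w p FinP.≟ a ⌋))
  accepts-automaton (x ≤' y) w σ =
    trans (leqStep-correct x y (letter w σ) (fo σ x) (fo σ y) (λ p → refl) (λ p → refl) false false)
          (leqF≡≤? (fo σ x) (fo σ y))
  accepts-automaton (x ∈' X) w σ =
    trans (accepts-someLetter (memberAt x X) (memberAt-≈ x X) (letter w σ)) (anyF-eqF (fo σ x) (so σ X))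
  accepts-automaton (¬' φ)   w σ = cong not (accepts-automaton φ w σ)
  accepts-automaton (φ ∧' ψ) w σ =
    trans (accepts-product (automaton φ) (automaton ψ) (letters w σ))
          (cong₂ _∧_ (accepts-automaton φ w σ) (accepts-automaton ψ w σ))
  accepts-automaton (∀₁ x φ) {n} w σ = begin
    not (accepts (determinise (projectFO x (complement (automaton φ)))) (letters w σ))
      ≡⟨ cong not (accepts-projectFO x (complement (automaton φ)) w σ) ⟩
    not (anyF (λ i → not (accepts (automaton φ) (letters w (σ [ x ↦₁ i ])))))
      ≡⟨ cong not (anyF-cong (λ i → cong not (accepts-automaton φ w (σ [ x ↦₁ i ])))) ⟩
    not (anyF (λ i → not (sat w (σ [ x ↦₁ i ]) φ)))
      ≡⟨ sym (allF≡not-anyF-not (λ i → sat w (σ [ x ↦₁ i ]) φ)) ⟩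
    allF (λ i → sat w (σ [ x ↦₁ i ]) φ)
      ≡⟨ sym (allB-tabulate (λ i → sat w (σ [ x ↦₁ i ]) φ) (λ i → i)) ⟩
    sat w σ (∀₁ x φ)
      ∎
    where open ≡-Reasoning
  accepts-automaton (∀₂ X φ) {n} w σ = begin
    not (accepts (determinise (projectSO X (complement (automaton φ)))) (letters w σ))
      ≡⟨ cong not (accepts-projectSO X (complement (automaton φ)) w σ) ⟩
    not (any (λ S → not (accepts (automaton φ) (letters w (σ [ X ↦₂ S ])))) (subsets n))
      ≡⟨ cong not (any-cong (subsets n) (λ S → cong not (accepts-automaton φ w (σ [ X ↦₂ S ])))) ⟩
    not (any (λ S → not (sat w (σ [ X ↦₂ S ]) φ)) (subsets n))
      ≡⟨ sym (allB≡not-any-not (λ S → sat w (σ [ X ↦₂ S ]) φ) (subsets n)) ⟩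
    sat w σ (∀₂ X φ)
      ∎
    where open ≡-Reasoning

  -- Under σ₀ all first-order variables sit at the first position and all sets are empty.
  firstLetter laterLetter : Fin k → Letter
  firstLetter a = mkLetter a (λ _ → true)  (λ _ → false)
  laterLetter a = mkLetter a (λ _ → false) (λ _ → false)

  accepts-σ₀ : ∀ A {m} a (v : Vec (Fin k) m) →
    accepts A (letters (a V.∷ v) σ₀)
      ≡ DFA.final A (foldl (λ s b → DFA.step A s (laterLetter b))
                           (DFA.step A (DFA.start A) (firstLetter a)) (V.toList v))
  accepts-σ₀ A a v = cong (DFA.final A) (run v _)
    where
    open DFA A
    run : ∀ {m} (v : Vec (Fin k) m) s →
      foldl step s (tabulate (λ p → letter (a V.∷ v) σ₀ (suc p)))
        ≡ foldl (λ s b → step s (laterLetter b)) s (V.toList v)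
    run V.[]      s = refl
    run (b V.∷ v) s = run v _

  NonEmpty : DFA → Set
  NonEmpty A = ∃ λ m → ∃ λ (w : Vec (Fin k) (suc m)) → accepts A (letters w σ₀) ≡ true

  nonEmpty? : ∀ A → Dec (NonEmpty A)
  nonEmpty? A = Dec.map′ witness unwitness
    (FinP.any? (λ a → reachable? (step start (firstLetter a))))
    where
    open DFA A
    open Reachability finite (λ s b → step s (laterLetter b)) final
    witness : (∃ λ a → ∃ λ as → final (run (step start (firstLetter a)) as) ≡ true) → NonEmpty A
    witness (a , as , e) =
      length as , a V.∷ V.fromList as ,
      trans (accepts-σ₀ A a (V.fromList as)) (trans (cong (λ l → final (run _ l)) (VP.toList∘fromList as)) e)
    unwitness : NonEmpty A → ∃ λ a → ∃ λ as → final (run (step start (firstLetter a)) as) ≡ true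
    unwitness (m , a V.∷ v , e) = a , V.toList v , trans (sym (accepts-σ₀ A a v)) e

satisfiable? : ∀ {k} (Δ : List (Formula k)) → Dec (Satisfiable Δ)
satisfiable? {k} Δ = Dec.map′
  (λ (m , w , e) → closure⇒satisfiable Δ w (trans (sym (accepts-automaton (closure Δ) w σ₀)) e))
  (λ (m , w , σ , h) → m , w , trans (accepts-automaton (closure Δ) w σ₀) (satisfiable⇒closure Δ w σ h))
  (nonEmpty? (automaton (closure Δ)))
  where open Automata k

-- Completeness for normal forms

module Completeness {k : ℕ} {R : Set} (_⊢ᴹ_ : List (Formula k) → Formula k → Set) (complete : Complete _⊢ᴹ_) where
  module PS = ProofSystem {k} {R} _⊢ᴹ_
  open PS using (_⊢ᶜ_≈_; _⊢ˢ_≈_)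

  -- An unsatisfiable context proves both ⊤ and ¬⊤, so C7 and C8 (or S2 and S3) identify anything.
  ⊢⊤ : ∀ {Δ} → Δ ⊢ᴹ ⊤'
  ⊢⊤ {Δ} = complete Δ ⊤' (λ _ _ _ _ → refl)

  unsat⇒⊢¬⊤ : ∀ {Δ} → ¬ Satisfiable Δ → Δ ⊢ᴹ (¬' ⊤')
  unsat⇒⊢¬⊤ {Δ} u = complete Δ (¬' ⊤') (λ m w σ h → ⊥-elim (u (m , w , σ , h)))

  unsat⇒⊢ᶜ : ∀ {Δ Φ Φ′} → ¬ Satisfiable Δ → Δ ⊢ᶜ Φ ≈ Φ′
  unsat⇒⊢ᶜ u = PS.trans (PS.sym (PS.C8 (unsat⇒⊢¬⊤ u))) (PS.trans PS.C7 (PS.C8 ⊢⊤))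

  unsat⇒⊢ˢ : ∀ {Δ Ψ Ψ′} → ¬ Satisfiable Δ → Δ ⊢ˢ Ψ ≈ Ψ′
  unsat⇒⊢ˢ u = PS.trans (PS.sym (PS.S3 (unsat⇒⊢¬⊤ u))) (PS.trans PS.S2 (PS.S3 ⊢⊤))

  -- C9 applied to φ ? Φ : Φ ≈ Φ turns into a case split on φ.
  ⊢ᶜ-cases : ∀ {Δ Φ Φ′} φ → (φ ∷ Δ) ⊢ᶜ Φ ≈ Φ′ → (¬' φ ∷ Δ) ⊢ᶜ Φ ≈ Φ′ → Δ ⊢ᶜ Φ ≈ Φ′
  ⊢ᶜ-cases φ h₁ h₂ = PS.trans (PS.sym (PS.C9 PS.ref PS.ref)) (PS.C9 h₁ h₂)

  cond-∼⁺ : ∀ {Δ φ} {Φ₁ Φ₂ Φ : Core k R} → cond φ Φ₁ Φ₂ ∼[ Δ ] Φ → Φ₁ ∼[ φ ∷ Δ ] Φ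
  cond-∼⁺ {Φ₁ = Φ₁} {Φ₂} {Φ} H m w σ (hφ ∷ h) =
    subst (λ b → (if b then ⟦ Φ₁ ⟧ᶜ w σ else ⟦ Φ₂ ⟧ᶜ w σ) ↭ ⟦ Φ ⟧ᶜ w σ) hφ (H m w σ h)

  cond-∼⁻ : ∀ {Δ φ} {Φ₁ Φ₂ Φ : Core k R} → cond φ Φ₁ Φ₂ ∼[ Δ ] Φ → Φ₂ ∼[ ¬' φ ∷ Δ ] Φ
  cond-∼⁻ {Φ₁ = Φ₁} {Φ₂} {Φ} H m w σ (hφ ∷ h) =
    subst (λ b → (if b then ⟦ Φ₁ ⟧ᶜ w σ else ⟦ Φ₂ ⟧ᶜ w σ) ↭ ⟦ Φ ⟧ᶜ w σ) (not-flip hφ) (H m w σ h)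

  ∼-cond⁺ : ∀ {Δ φ} {Φ Φ₁ Φ₂ : Core k R} → Φ ∼[ Δ ] cond φ Φ₁ Φ₂ → Φ ∼[ φ ∷ Δ ] Φ₁
  ∼-cond⁺ {Φ = Φ} {Φ₁} {Φ₂} H m w σ (hφ ∷ h) =
    subst (λ b → ⟦ Φ ⟧ᶜ w σ ↭ (if b then ⟦ Φ₁ ⟧ᶜ w σ else ⟦ Φ₂ ⟧ᶜ w σ)) hφ (H m w σ h)

  ∼-cond⁻ : ∀ {Δ φ} {Φ Φ₁ Φ₂ : Core k R} → Φ ∼[ Δ ] cond φ Φ₁ Φ₂ → Φ ∼[ ¬' φ ∷ Δ ] Φ₂
  ∼-cond⁻ {Φ = Φ} {Φ₁} {Φ₂} H m w σ (hφ ∷ h) =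
    subst (λ b → ⟦ Φ ⟧ᶜ w σ ↭ (if b then ⟦ Φ₁ ⟧ᶜ w σ else ⟦ Φ₂ ⟧ᶜ w σ)) (not-flip hφ) (H m w σ h)

  -- lits fixes, for every c in cs, whether some position z satisfies c.
  data Choice (z : ℕ) : List (Formula k) → List (Formula k) → Set where
    []   : Choice z [] []
    _∷⁺_ : ∀ {cs lits} c → Choice z cs lits → Choice z (c ∷ cs) (∃₁ z c ∷ lits)
    _∷⁻_ : ∀ {cs lits} c → Choice z cs lits → Choice z (c ∷ cs) (¬' ∃₁ z c ∷ lits)

  ⊢ᶜ-choices : ∀ z cs Δ {Φ Φ′} → (∀ {lits} → Choice z cs lits → (lits ++ Δ) ⊢ᶜ Φ ≈ Φ′) → Δ ⊢ᶜ Φ ≈ Φ′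
  ⊢ᶜ-choices z []       Δ h = h []
  ⊢ᶜ-choices z (c ∷ cs) Δ h =
    ⊢ᶜ-choices z cs Δ (λ {lits} ch → ⊢ᶜ-cases (∃₁ z c) (h (c ∷⁺ ch)) (h (c ∷⁻ ch)))

  Resolves : ℕ → List (Formula k) → List (Formula k) → Set
  Resolves z cs Δ = ∀ c → c ∈ cs → (∃₁ z c ∈ Δ) ⊎ (¬' ∃₁ z c ∈ Δ)

  choice-resolves : ∀ {z cs lits} → Choice z cs lits → Resolves z cs lits
  choice-resolves (c ∷⁺ ch) .c (here refl) = inj₁ (here refl)
  choice-resolves (c ∷⁻ ch) .c (here refl) = inj₂ (here refl)
  choice-resolves (c ∷⁺ ch) c′ (there c′∈) = Sum.map there there (choice-resolves ch c′ c′∈)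
  choice-resolves (c ∷⁻ ch) c′ (there c′∈) = Sum.map there there (choice-resolves ch c′ c′∈)

  choice-notFree : ∀ {z cs lits} → Choice z cs lits → NotFreeIn z lits
  choice-notFree {z} []        = []
  choice-notFree {z} (c ∷⁺ ch) = cong (λ b → not b ∧ freeFO z c) (≡ᵇ-refl z) ∷ choice-notFree ch
  choice-notFree {z} (c ∷⁻ ch) = cong (λ b → not b ∧ freeFO z c) (≡ᵇ-refl z) ∷ choice-notFree ch

  Invariant : ℕ → Formula k → Set
  Invariant z φ = ∀ {n} (w : Vec (Fin k) n) σ i → sat w (σ [ z ↦₁ i ]) φ ≡ sat w σ φ

  bound-invariant : ∀ {z} φ → bound φ ≤ z → Invariant z φ
  bound-invariant φ le w σ i =
    sat-coincide φ w le ((λ v lt → cong (if_then i else fo σ v) (<⇒≡ᵇ-false lt)) , λ _ _ _ → refl)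

  choice-invariant : ∀ {z cs lits} → Choice z cs lits → All (Invariant z) lits
  choice-invariant {z} []        = []
  choice-invariant {z} (c ∷⁺ ch) = (λ w σ i → sat-∃₁-↦₁ w σ z i c) ∷ choice-invariant ch
  choice-invariant {z} (c ∷⁻ ch) = (λ w σ i → cong not (sat-∃₁-↦₁ w σ z i c)) ∷ choice-invariant ch

  Holds-↦₁ : ∀ {z Δ} → All (Invariant z) Δ → ∀ {n} (w : Vec (Fin k) n) σ i → Holds Δ w σ → Holds Δ w (σ [ z ↦₁ i ])
  Holds-↦₁ []         w σ i []       = []
  Holds-↦₁ (inv ∷ is) w σ i (h ∷ hs) = trans (inv w σ i) h ∷ Holds-↦₁ is w σ i hs

  Summand : Set
  Summand = ℕ × Step k R

  ⟦_⟧ᵖ : ∀ {n} → Summand → Vec (Fin k) n → Val n → List R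
  ⟦ x , Ψ ⟧ᵖ w σ = tabulate (λ i → ⟦ Ψ ⟧ˢ w (σ [ x ↦₁ i ]))

  ∑ : List Summand → Core k R
  ∑ []             = 𝟎
  ∑ ((x , Ψ) ∷ ps) = prod x Ψ ⊕ ∑ ps

  ⟦∑-++⟧ : ∀ ps qs {n} (w : Vec (Fin k) n) σ → ⟦ ∑ (ps ++ qs) ⟧ᶜ w σ ≡ ⟦ ∑ ps ⟧ᶜ w σ ++ ⟦ ∑ qs ⟧ᶜ w σ
  ⟦∑-++⟧ []       qs w σ = refl
  ⟦∑-++⟧ (p ∷ ps) qs w σ = cong (⟦ p ⟧ᵖ w σ ∷_) (⟦∑-++⟧ ps qs w σ)

  ⊢∑-++ : ∀ {Δ} ps qs → Δ ⊢ᶜ ∑ ps ⊕ ∑ qs ≈ ∑ (ps ++ qs)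
  ⊢∑-++ []       qs = PS.trans PS.C2 PS.C1
  ⊢∑-++ (p ∷ ps) qs = PS.trans PS.C3 (PS.cong+ PS.ref (⊢∑-++ ps qs))

  ⊢∑-mid : ∀ {Δ} ps qs q → Δ ⊢ᶜ ∑ (q ∷ ps ++ qs) ≈ ∑ (ps ++ q ∷ qs)
  ⊢∑-mid []       qs q = PS.ref
  ⊢∑-mid (p ∷ ps) qs q =
    PS.trans (PS.sym PS.C3) (PS.trans (PS.cong+ PS.C2 PS.ref) (PS.trans PS.C3 (PS.cong+ PS.ref (⊢∑-mid ps qs q))))

  summands : ∀ {M : Core k R} → IsM M → List Summand
  summands (m-prod x Ψ) = (x , Ψ) ∷ []
  summands (m-plus a b) = summands a ++ summands b

  ⊢summands : ∀ {Δ M} (m : IsM M) → Δ ⊢ᶜ M ≈ ∑ (summands m)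
  ⊢summands (m-prod x Ψ) = PS.sym PS.C1
  ⊢summands (m-plus a b) = PS.trans (PS.cong+ (⊢summands a) (⊢summands b)) (⊢∑-++ (summands a) (summands b))

  ⟦summands⟧ : ∀ {M n} (m : IsM M) (w : Vec (Fin k) n) σ → ⟦ M ⟧ᶜ w σ ≡ ⟦ ∑ (summands m) ⟧ᶜ w σ
  ⟦summands⟧ (m-prod x Ψ) w σ = refl
  ⟦summands⟧ (m-plus a b) w σ =
    trans (cong₂ _++_ (⟦summands⟧ a w σ) (⟦summands⟧ b w σ)) (sym (⟦∑-++⟧ (summands a) (summands b) w σ))

  IsM-nonempty : ∀ {M : Core k R} {n} → IsM M → (w : Vec (Fin k) n) → ∀ σ → length (⟦ M ⟧ᶜ w σ) ≢ 0
  IsM-nonempty (m-prod x Ψ) w σ ()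
  IsM-nonempty (m-plus {M₁} {M₂} a b) w σ e =
    IsM-nonempty a w σ (ℕP.m+n≡0⇒m≡0 (length (⟦ M₁ ⟧ᶜ w σ)) (trans (sym (LP.length-++ (⟦ M₁ ⟧ᶜ w σ))) e))

  ∈-∑ : ∀ qs {n} (w : Vec (Fin k) n) σ v → v ∈ ⟦ ∑ qs ⟧ᶜ w σ →
    ∃ λ ps → ∃ λ q → ∃ λ rs → qs ≡ ps ++ q ∷ rs × ⟦ q ⟧ᵖ w σ ≡ v
  ∈-∑ (q ∷ qs) w σ v (here e) = [] , q , qs , refl , sym e
  ∈-∑ (q ∷ qs) w σ v (there v∈) =
    let ps , q′ , rs , e₁ , e₂ = ∈-∑ qs w σ v v∈ in q ∷ ps , q′ , rs , cong (q ∷_) e₁ , e₂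

  -- One condition per pair of leaves: the conjunction of the guards leading to both.
  leafConditions : List (Formula k) → Step k R → Step k R → List (Formula k)
  leafConditions Ls (cond φ A₁ A₂) B =
    leafConditions (φ ∷ Ls) A₁ B ++ leafConditions (¬' φ ∷ Ls) A₂ B
  leafConditions Ls (wt r) (cond ψ B₁ B₂) =
    leafConditions (ψ ∷ Ls) (wt r) B₁ ++ leafConditions (¬' ψ ∷ Ls) (wt r) B₂
  leafConditions Ls (wt r) (wt r′) = conj Ls ∷ []

  LeavesAgree : List (Formula k) → List (Formula k) → Step k R → Step k R → Set
  LeavesAgree Δ Ls (cond φ A₁ A₂) B =
    LeavesAgree Δ (φ ∷ Ls) A₁ B × LeavesAgree Δ (¬' φ ∷ Ls) A₂ B
  LeavesAgree Δ Ls (wt r) (cond ψ B₁ B₂) =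
    LeavesAgree Δ (ψ ∷ Ls) (wt r) B₁ × LeavesAgree Δ (¬' ψ ∷ Ls) (wt r) B₂
  LeavesAgree Δ Ls (wt r) (wt r′) = ¬ Satisfiable (Ls ++ Δ) ⊎ r ≡ r′

  leavesAgree⇒⊢ˢ : ∀ Δ Ls A B → LeavesAgree Δ Ls A B → (Ls ++ Δ) ⊢ˢ A ≈ B
  leavesAgree⇒⊢ˢ Δ Ls (cond φ A₁ A₂) B (g₁ , g₂) =
    PS.S4 (leavesAgree⇒⊢ˢ Δ (φ ∷ Ls) A₁ B g₁) (leavesAgree⇒⊢ˢ Δ (¬' φ ∷ Ls) A₂ B g₂)
  leavesAgree⇒⊢ˢ Δ Ls (wt r) (cond ψ B₁ B₂) (g₁ , g₂) =
    PS.sym (PS.S4 (PS.sym (leavesAgree⇒⊢ˢ Δ (ψ ∷ Ls) (wt r) B₁ g₁))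
                  (PS.sym (leavesAgree⇒⊢ˢ Δ (¬' ψ ∷ Ls) (wt r) B₂ g₂)))
  leavesAgree⇒⊢ˢ Δ Ls (wt r) (wt r′) (inj₁ u)    = unsat⇒⊢ˢ u
  leavesAgree⇒⊢ˢ Δ Ls (wt r) (wt .r) (inj₂ refl) = PS.ref

  leavesAgree⇒≡ : ∀ Δ Ls A B → LeavesAgree Δ Ls A B →
    ∀ {m} (w : Vec (Fin k) (suc m)) τ → Holds (Ls ++ Δ) w τ → ⟦ A ⟧ˢ w τ ≡ ⟦ B ⟧ˢ w τ
  leavesAgree⇒≡ Δ Ls (cond φ A₁ A₂) B (g₁ , g₂) w τ h with sat w τ φ in eq
  ... | true  = leavesAgree⇒≡ Δ (φ ∷ Ls) A₁ B g₁ w τ (eq ∷ h)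
  ... | false = leavesAgree⇒≡ Δ (¬' φ ∷ Ls) A₂ B g₂ w τ (cong not eq ∷ h)
  leavesAgree⇒≡ Δ Ls (wt r) (cond ψ B₁ B₂) (g₁ , g₂) w τ h with sat w τ ψ in eq
  ... | true  = leavesAgree⇒≡ Δ (ψ ∷ Ls) (wt r) B₁ g₁ w τ (eq ∷ h)
  ... | false = leavesAgree⇒≡ Δ (¬' ψ ∷ Ls) (wt r) B₂ g₂ w τ (cong not eq ∷ h)
  leavesAgree⇒≡ Δ Ls (wt r) (wt r′) (inj₁ u) w τ h = ⊥-elim (u (_ , w , τ , h))
  leavesAgree⇒≡ Δ Ls (wt r) (wt r′) (inj₂ e) w τ h = e

  -- If Δ decides, for each leaf, whether some position z reaches it, then the leaves agree:
  -- a reachable leaf is reached in the model (w, σ), where A₀ and B₀ agree at every position.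
  module Leaves (Δ : List (Formula k)) (z : ℕ) (A₀ B₀ : Step k R)
    {m} (w : Vec (Fin k) (suc m)) (σ : Val (suc m)) (model : Holds Δ w σ)
    (agree : ∀ i → ⟦ A₀ ⟧ˢ w (σ [ z ↦₁ i ]) ≡ ⟦ B₀ ⟧ˢ w (σ [ z ↦₁ i ])) where

    Tracks : List (Formula k) → Step k R → Step k R → Set
    Tracks Ls A B = ∀ {m} (w : Vec (Fin k) (suc m)) τ → Holds Ls w τ →
      ⟦ A₀ ⟧ˢ w τ ≡ ⟦ A ⟧ˢ w τ × ⟦ B₀ ⟧ˢ w τ ≡ ⟦ B ⟧ˢ w τ

    leaf : ∀ Ls r r′ → Tracks Ls (wt r) (wt r′) → (∃₁ z (conj Ls) ∈ Δ) ⊎ (¬' ∃₁ z (conj Ls) ∈ Δ) →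
      LeavesAgree Δ Ls (wt r) (wt r′)
    leaf Ls r r′ tracks (inj₁ reached) =
      let i , e = sat-∃₁⁻ w σ z (conj Ls) (All.lookup model reached)
          eA , eB = tracks w (σ [ z ↦₁ i ]) (sat-conj⁻ Ls w e)
      in inj₂ (trans (sym eA) (trans (agree i) eB))
    leaf Ls r r′ tracks (inj₂ unreached) = inj₁ λ (_ , w′ , τ , h) →
      false≢true (trans (sym (not-flip (All.lookup (AllP.++⁻ʳ Ls h) unreached)))
        (sat-∃₁⁺ w′ τ z (conj Ls) (fo τ z)
          (trans (sat-≗ (conj Ls) w′ (↦₁-self τ z) (λ _ _ → refl)) (sat-conj⁺ Ls w′ (AllP.++⁻ˡ Ls h)))))

    tracks-then : ∀ {Ls} φ A₁ A₂ B → Tracks Ls (cond φ A₁ A₂) B → Tracks (φ ∷ Ls) A₁ B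
    tracks-then φ A₁ A₂ B tracks w τ (h ∷ hs) = let eA , eB = tracks w τ hs in trans eA (⟦cond⟧-then φ A₁ A₂ h) , eB

    tracks-else : ∀ {Ls} φ A₁ A₂ B → Tracks Ls (cond φ A₁ A₂) B → Tracks (¬' φ ∷ Ls) A₂ B
    tracks-else φ A₁ A₂ B tracks w τ (h ∷ hs) = let eA , eB = tracks w τ hs in trans eA (⟦cond⟧-else φ A₁ A₂ h) , eB

    tracks-thenʳ : ∀ {Ls} A ψ B₁ B₂ → Tracks Ls A (cond ψ B₁ B₂) → Tracks (ψ ∷ Ls) A B₁
    tracks-thenʳ A ψ B₁ B₂ tracks w τ (h ∷ hs) = let eA , eB = tracks w τ hs in eA , trans eB (⟦cond⟧-then ψ B₁ B₂ h)

    tracks-elseʳ : ∀ {Ls} A ψ B₁ B₂ → Tracks Ls A (cond ψ B₁ B₂) → Tracks (¬' ψ ∷ Ls) A B₂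
    tracks-elseʳ A ψ B₁ B₂ tracks w τ (h ∷ hs) = let eA , eB = tracks w τ hs in eA , trans eB (⟦cond⟧-else ψ B₁ B₂ h)

    leavesAgree : ∀ Ls A B → Tracks Ls A B → Resolves z (leafConditions Ls A B) Δ → LeavesAgree Δ Ls A B
    leavesAgree Ls (cond φ A₁ A₂) B tracks res =
      leavesAgree (φ ∷ Ls) A₁ B (tracks-then φ A₁ A₂ B tracks)
        (λ c c∈ → res c (∈-++⁺ˡ c∈)) ,
      leavesAgree (¬' φ ∷ Ls) A₂ B (tracks-else φ A₁ A₂ B tracks)
        (λ c c∈ → res c (∈-++⁺ʳ (leafConditions (φ ∷ Ls) A₁ B) c∈))
    leavesAgree Ls (wt r) (cond ψ B₁ B₂) tracks res =
      leavesAgree (ψ ∷ Ls) (wt r) B₁ (tracks-thenʳ (wt r) ψ B₁ B₂ tracks)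
        (λ c c∈ → res c (∈-++⁺ˡ c∈)) ,
      leavesAgree (¬' ψ ∷ Ls) (wt r) B₂ (tracks-elseʳ (wt r) ψ B₁ B₂ tracks)
        (λ c c∈ → res c (∈-++⁺ʳ (leafConditions (ψ ∷ Ls) (wt r) B₁) c∈))
    leavesAgree Ls (wt r) (wt r′) tracks res = leaf Ls r r′ tracks (res (conj Ls) (here refl))

  summand-match : ∀ Δ z → NotFreeIn z Δ → All (Invariant z) Δ → ∀ x Ψ y Ψ′ → boundStep Ψ ≤ z → boundStep Ψ′ ≤ z →
    Resolves z (leafConditions [] (substStep z x Ψ) (substStep z y Ψ′)) Δ →
    ∀ {m} (w : Vec (Fin k) (suc m)) σ → Holds Δ w σ → ⟦ x , Ψ ⟧ᵖ w σ ≡ ⟦ y , Ψ′ ⟧ᵖ w σ →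
    (Δ ⊢ᶜ prod x Ψ ≈ prod y Ψ′) × (∀ {m} (w : Vec (Fin k) (suc m)) σ → Holds Δ w σ → ⟦ x , Ψ ⟧ᵖ w σ ≡ ⟦ y , Ψ′ ⟧ᵖ w σ)
  summand-match Δ z notFree invariant x Ψ y Ψ′ leΨ leΨ′ res w σ model same =
    PS.trans (PS.C5 (occursStep-bound Ψ z leΨ))
      (PS.trans (PS.C4 (leavesAgree⇒⊢ˢ Δ [] A₀ B₀ agreeing) notFree) (PS.sym (PS.C5 (occursStep-bound Ψ′ z leΨ′)))) ,
    λ w′ τ h → LP.tabulate-cong λ i →
      trans (sym (⟦⟧ˢ-rename Ψ w′ τ z x i leΨ))
        (trans (leavesAgree⇒≡ Δ [] A₀ B₀ agreeing w′ (τ [ z ↦₁ i ]) (Holds-↦₁ invariant w′ τ i h))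
               (⟦⟧ˢ-rename Ψ′ w′ τ z y i leΨ′))
    where
    A₀ = substStep z x Ψ
    B₀ = substStep z y Ψ′
    agree : ∀ i → ⟦ A₀ ⟧ˢ w (σ [ z ↦₁ i ]) ≡ ⟦ B₀ ⟧ˢ w (σ [ z ↦₁ i ])
    agree i = trans (⟦⟧ˢ-rename Ψ w σ z x i leΨ)
                (trans (tabulate-injective {f = λ i → ⟦ Ψ ⟧ˢ w (σ [ x ↦₁ i ])} {g = λ i → ⟦ Ψ′ ⟧ˢ w (σ [ y ↦₁ i ])} same i)
                       (sym (⟦⟧ˢ-rename Ψ′ w σ z y i leΨ′)))
    agreeing : LeavesAgree Δ [] A₀ B₀
    agreeing = Leaves.leavesAgree Δ z A₀ B₀ w σ model agree [] A₀ B₀ (λ _ _ _ → refl , refl) res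

  ∑-cancel : ∀ {Δ} p ps q as bs → (∀ {m} (w : Vec (Fin k) (suc m)) σ → Holds Δ w σ → ⟦ p ⟧ᵖ w σ ≡ ⟦ q ⟧ᵖ w σ) →
    ∑ (p ∷ ps) ∼[ Δ ] ∑ (as ++ q ∷ bs) → ∑ ps ∼[ Δ ] ∑ (as ++ bs)
  ∑-cancel p ps q as bs same H m w σ h =
    subst (⟦ ∑ ps ⟧ᶜ w σ ↭_) (sym (⟦∑-++⟧ as bs w σ))
      (↭P.drop-mid [] (⟦ ∑ as ⟧ᶜ w σ)
        (subst₂ _↭_ (cong (_∷ ⟦ ∑ ps ⟧ᶜ w σ) (same w σ h)) (⟦∑-++⟧ as (q ∷ bs) w σ) (H m w σ h)))

  boundSummands : List Summand → ℕ
  boundSummands []             = 0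
  boundSummands ((y , Ψ) ∷ qs) = boundStep Ψ ⊔ boundSummands qs

  boundSummands-mid : ∀ as y Ψ bs → boundStep Ψ ≤ boundSummands (as ++ (y , Ψ) ∷ bs)
  boundSummands-mid []             y Ψ bs = ℕP.m≤m⊔n (boundStep Ψ) _
  boundSummands-mid ((x , Φ) ∷ as) y Ψ bs = ℕP.≤-trans (boundSummands-mid as y Ψ bs) (ℕP.m≤n⊔m (boundStep Φ) _)

  ∑-complete : ∀ ps qs Δ → ∑ ps ∼[ Δ ] ∑ qs → Δ ⊢ᶜ ∑ ps ≈ ∑ qs
  ∑-complete []             []       Δ H = PS.ref
  ∑-complete []             (q ∷ qs) Δ H = unsat⇒⊢ᶜ λ (m , w , σ , h) → ℕP.0≢1+n (↭P.↭-length (H m w σ h))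
  ∑-complete ((x , Ψ) ∷ ps) qs       Δ H = ⊢ᶜ-choices z (concatMap conditions qs) Δ branch
    where
    z = bound (conj Δ) ⊔ (boundStep Ψ ⊔ boundSummands qs)
    leΨ : boundStep Ψ ≤ z
    leΨ = ℕP.≤-trans (ℕP.m≤m⊔n (boundStep Ψ) _) (ℕP.m≤n⊔m (bound (conj Δ)) _)
    conditions : Summand → List (Formula k)
    conditions (y , Ψ′) = leafConditions [] (substStep z x Ψ) (substStep z y Ψ′)
    branch : ∀ {lits} → Choice z (concatMap conditions qs) lits → (lits ++ Δ) ⊢ᶜ ∑ ((x , Ψ) ∷ ps) ≈ ∑ qs
    branch {lits} ch with satisfiable? (lits ++ Δ)
    ... | no unsat = unsat⇒⊢ᶜ unsat
    ... | yes (m , w , σ , h) = matched (∈-∑ qs w σ _ (↭P.∈-resp-↭ (H m w σ (AllP.++⁻ʳ lits h)) (here refl)))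
      where
      Δ′ = lits ++ Δ
      notFree : NotFreeIn z Δ′
      notFree = AllP.++⁺ (choice-notFree ch)
        (All.map (λ {φ} le → freeFO-bound φ z (ℕP.≤-trans le (ℕP.m≤m⊔n _ _))) (bound-conj Δ))
      invariant : All (Invariant z) Δ′
      invariant = AllP.++⁺ (choice-invariant ch)
        (All.map (λ {φ} le {n} → bound-invariant φ (ℕP.≤-trans le (ℕP.m≤m⊔n _ _)) {n}) (bound-conj Δ))
      matched : (∃ λ as → ∃ λ q → ∃ λ bs → qs ≡ as ++ q ∷ bs × ⟦ q ⟧ᵖ w σ ≡ ⟦ x , Ψ ⟧ᵖ w σ) →
                Δ′ ⊢ᶜ ∑ ((x , Ψ) ∷ ps) ≈ ∑ qs
      matched (as , (y , Ψ′) , bs , qs≡ , same) = subst (λ l → Δ′ ⊢ᶜ ∑ ((x , Ψ) ∷ ps) ≈ ∑ l) (sym qs≡)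
        (PS.trans (PS.cong+ derivation (∑-complete ps (as ++ bs) Δ′ (∑-cancel (x , Ψ) ps (y , Ψ′) as bs equal H′)))
                  (⊢∑-mid as bs (y , Ψ′)))
        where
        leΨ′ : boundStep Ψ′ ≤ z
        leΨ′ = ℕP.≤-trans (subst (λ l → boundStep Ψ′ ≤ boundSummands l) (sym qs≡) (boundSummands-mid as y Ψ′ bs))
                          (ℕP.≤-trans (ℕP.m≤n⊔m (boundStep Ψ) _) (ℕP.m≤n⊔m (bound (conj Δ)) _))
        res : Resolves z (conditions (y , Ψ′)) Δ′
        res c c∈ = Sum.map ∈-++⁺ˡ ∈-++⁺ˡ (choice-resolves ch c
          (∈-concatMap⁺ conditions
            (Any.map (λ { refl → c∈ }) (subst ((y , Ψ′) ∈_) (sym qs≡) (∈-++⁺ʳ as (here refl))))))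
        H′ : ∑ ((x , Ψ) ∷ ps) ∼[ Δ′ ] ∑ (as ++ (y , Ψ′) ∷ bs)
        H′ m w σ h = subst (λ l → ⟦ ∑ ((x , Ψ) ∷ ps) ⟧ᶜ w σ ↭ ⟦ ∑ l ⟧ᶜ w σ) qs≡ (H m w σ (AllP.++⁻ʳ lits h))
        match = summand-match Δ′ z notFree invariant x Ψ y Ψ′ leΨ leΨ′ res w σ h (sym same)
        derivation = proj₁ match
        equal = proj₂ match

  Base : Core k R → Set
  Base Φ = IsM Φ ⊎ Φ ≡ 𝟎

  base-complete : ∀ Δ {Φ₁ Φ₂} → Base Φ₁ → Base Φ₂ → Φ₁ ∼[ Δ ] Φ₂ → Δ ⊢ᶜ Φ₁ ≈ Φ₂
  base-complete Δ (inj₁ m₁) (inj₁ m₂) H =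
    PS.trans (⊢summands m₁) (PS.trans (∑-complete (summands m₁) (summands m₂) Δ H′) (PS.sym (⊢summands m₂)))
    where
    H′ : ∑ (summands m₁) ∼[ Δ ] ∑ (summands m₂)
    H′ m w σ h = subst₂ _↭_ (⟦summands⟧ m₁ w σ) (⟦summands⟧ m₂ w σ) (H m w σ h)
  base-complete Δ (inj₁ m₁) (inj₂ refl) H =
    unsat⇒⊢ᶜ λ (m , w , σ , h) → IsM-nonempty m₁ w σ (↭P.↭-length (H m w σ h))
  base-complete Δ (inj₂ refl) (inj₁ m₂) H =
    unsat⇒⊢ᶜ λ (m , w , σ , h) → IsM-nonempty m₂ w σ (sym (↭P.↭-length (H m w σ h)))
  base-complete Δ (inj₂ refl) (inj₂ refl) H = PS.ref

  nf-base-complete : ∀ Δ {Φ₁ Φ₂} → IsNF Φ₁ → Base Φ₂ → Φ₁ ∼[ Δ ] Φ₂ → Δ ⊢ᶜ Φ₁ ≈ Φ₂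
  nf-base-complete Δ {Φ₂ = Φ} (nf-cond φ {N₁} {N₂} n₁ n₂) b H =
    PS.C9 (nf-base-complete (φ ∷ Δ) n₁ b (cond-∼⁺ {Φ₁ = N₁} {N₂} {Φ} H))
          (nf-base-complete (¬' φ ∷ Δ) n₂ b (cond-∼⁻ {Φ₁ = N₁} {N₂} {Φ} H))
  nf-base-complete Δ (nf-M m) b H = base-complete Δ (inj₁ m) b H
  nf-base-complete Δ nf-𝟎     b H = base-complete Δ (inj₂ refl) b H

  nf-complete : ∀ Δ {Φ₁ Φ₂} → IsNF Φ₁ → IsNF Φ₂ → Φ₁ ∼[ Δ ] Φ₂ → Δ ⊢ᶜ Φ₁ ≈ Φ₂
  nf-complete Δ {Φ₁ = Φ} n (nf-cond φ {N₁} {N₂} n₁ n₂) H =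
    PS.sym (PS.C9 (PS.sym (nf-complete (φ ∷ Δ) n n₁ (∼-cond⁺ {Φ = Φ} {N₁} {N₂} H)))
                  (PS.sym (nf-complete (¬' φ ∷ Δ) n n₂ (∼-cond⁻ {Φ = Φ} {N₁} {N₂} H))))
  nf-complete Δ n (nf-M m) H = nf-base-complete Δ n (inj₁ m) H
  nf-complete Δ n nf-𝟎     H = nf-base-complete Δ n (inj₂ refl) H

lemma10 : ∀ {k : ℕ} {R : Set} (_⊢ᴹ_ : List (Formula k) → Formula k → Set) →
    Sound _⊢ᴹ_ → Complete _⊢ᴹ_ →
    (Γ : List (Formula k)) (Φ₁ Φ₂ : Core k R) →
    IsNF Φ₁ → IsNF Φ₂ → Φ₁ ∼[ Γ ] Φ₂ →
    ProofSystem._⊢ᶜ_≈_ {k} {R} _⊢ᴹ_ Γ Φ₁ Φ₂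
lemma10 _⊢ᴹ_ _ complete Γ Φ₁ Φ₂ = Completeness.nf-complete _⊢ᴹ_ complete Γ
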